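{- For $k\geqslant0$ let $G_k$ be the graph defined below. Then: (1) For every $k\geqslant0$, $G_k$ has $2^{k+2}-2$ vertices and exactly two distinct maximum independent sets $I_k$ and $J_k$, of size $\alpha(G_k)=2^{k+1}-1$, and $\{I_k,J_k\}$ is a partition of $V(G_k)$. (2) There is a constant $c_1>0$ such that for every $k\geqslant 0$ and every path $(W_i)_{0\leqslant i\leqslant p}$ from $I_k$ to $J_k$ in the reconfiguration graph of $G_k$, there exists $0\leqslant i\leqslant p$ with $|W_i|\leqslant\alpha(G_k)-\lfloor c_1 k\rfloor$. (3) For every $k\geqslant0$ and $d\geqslant0$, $G_k$ has at most $2^{2d+1}\alpha(G_k)^d$ independent sets of size exactly $\alpha(G_k)-d$.
   Context: Let $T_k$ be the complete binary tree of depth $k$. The graph $G_k$ is obtained by replacing each node $t\in V(T_k)$ with a set $X_t=\{u_t,v_t\}$ of two adjacent vertices, and for each edge $tt'\in E(T_k)$ adding the two edges $u_tu_{t'}$ and $v_tv_{t'}$; there are no other edges. The reconfiguration graph of a graph $G$ has the independent sets of $G$ as vertices, two independent sets $I,J$ being adjacent iff $|I\triangle J|\leqslant1$; a path from $I$ to $J$ is a sequence $I=W_0,W_1,\dots,W_p=J$ of independent sets with $|W_i\triangle W_{i+1}|\leqslant1$ for all $i$. -}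

module Defs where

open import Data.Nat using (ℕ; zero; suc; _+_; _*_; _∸_; _^_; _≤_)
open import Data.Fin using (Fin; toℕ; splitAt; fromℕ; inject₁)
import Data.Fin as Fin
open import Data.Fin.Subset using (Subset; _∈_; ∣_∣)
open import Data.Bool using (_xor_)
open import Data.Vec using (zipWith)
open import Data.Sum using (_⊎_; inj₁; inj₂)
open import Data.Product using (_×_; Σ)
open import Data.Empty using (⊥)
open import Relation.Binary.PropositionalEquality using (_≡_)
open import Relation.Nullary using (¬_)

record Graph : Set₁ where
  field
    n   : ℕ
    Adj : Fin n → Fin n → Set
open Graph public

-- The complete binary tree T_k of depth k, in heap numbering:
-- nodes 0 .. 2^(k+1)-2, root 0, the children of node t are 2t+1 and 2t+2.
nodes : ℕ → ℕ
nodes k = 2 ^ (k + 1) ∸ 1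

Child : ∀ {m} → Fin m → Fin m → Set
Child t t' = (toℕ t' ≡ 2 * toℕ t + 1) ⊎ (toℕ t' ≡ 2 * toℕ t + 2)

TreeAdj : ∀ {m} → Fin m → Fin m → Set
TreeAdj t t' = Child t t' ⊎ Child t' t

-- Vertices of G_k: Fin (m + m) with m = |V(T_k)|; index inj₁ t is u_t,
-- index inj₂ t is v_t (via splitAt).
AdjSplit : ∀ {m} → Fin m ⊎ Fin m → Fin m ⊎ Fin m → Set
AdjSplit (inj₁ t) (inj₁ t') = TreeAdj t t'
AdjSplit (inj₂ t) (inj₂ t') = TreeAdj t t'
AdjSplit (inj₁ t) (inj₂ t') = t ≡ t'
AdjSplit (inj₂ t) (inj₁ t') = t ≡ t'

G : ℕ → Graph
G k = record
  { n   = nodes k + nodes k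
  ; Adj = λ i j → AdjSplit (splitAt (nodes k) i) (splitAt (nodes k) j)
  }

Independent : (H : Graph) → Subset (n H) → Set
Independent H S = ∀ i j → i ∈ S → j ∈ S → ¬ Adj H i j

MaximumIndependent : (H : Graph) → Subset (n H) → Set
MaximumIndependent H S =
  Independent H S × (∀ T → Independent H T → ∣ T ∣ ≤ ∣ S ∣)

IsIndependenceNumber : Graph → ℕ → Set
IsIndependenceNumber H a = Σ (Subset (n H)) (λ S → MaximumIndependent H S × ∣ S ∣ ≡ a)

_△_ : ∀ {m} → Subset m → Subset m → Subset m
S △ T = zipWith _xor_ S T

record ReconfPath (H : Graph) (I J : Subset (n H)) : Set where
  field
    p      : ℕ
    W      : Fin (suc p) → Subset (n H)
    indep  : ∀ i → Independent H (W i)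
    start  : W Fin.zero ≡ I
    finish : W (Fin.fromℕ p) ≡ J
    step   : ∀ (i : Fin p) → ∣ W (Fin.inject₁ i) △ W (Fin.suc i) ∣ ≤ 1

module Submission where

-- An independent set S of G_k meets each X_t in at most one vertex; call t a hole of S if it
-- meets none, and otherwise colour t by whether u_t or v_t lies in S. Then |S| = |T_k| − #holes,
-- and colours alternate along every tree edge between non-holes. So S is determined by the colour
-- of the root together with, for every hole p, the colours of the two children of p: without holes
-- this leaves the two alternating colourings I_k and J_k, and with d holes at most 2 (4 |T_k|)^d sets.
--
-- Along a reconfiguration path a node cannot change colour in one step, so it passes through a hole.
-- By induction on j, recolouring an alternating subtree of depth j forces ⌊j/2⌋+1 simultaneous
-- holes into it: for depth j+2 consider three of the four grandchild subtrees; whenever one of them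
-- carries its ⌊j/2⌋+1 holes while the whole subtree carries no more, the other two alternate in
-- phase, and a back-and-forth argument shows that then not all three can be recoloured. For the
-- whole tree this yields a set of size at most α − ⌊k/2⌋ − 1 on the path, so c₁ = ½ works.

open import Defs
open import Data.Nat as ℕ
  using (ℕ; zero; suc; _+_; _*_; _∸_; _^_; _≤_; _<_; z≤n; s≤s; _≤?_; _<?_; ⌊_/2⌋)
open import Data.Nat.Properties
open import Data.Nat.Induction using (<-rec)
open import Data.Nat.Tactic.RingSolver using (solve-∀)
open import Data.Bool as Bool using (Bool; true; false; _∧_; not; _xor_; if_then_else_)
open import Data.Bool.Properties using (not-involutive; ¬-not; not-¬)
open import Data.Maybe using (Maybe; just; nothing; is-just)
open import Data.Maybe.Properties using (just-injective)
open import Data.List using (List; []; _∷_; length; map; upTo; cartesianProduct; cartesianProductWith)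
open import Data.List.Properties using (length-++; length-map; length-upTo)
open import Data.List.Membership.Propositional using () renaming (_∈_ to _∈ˡ_)
open import Data.List.Membership.Propositional.Properties using (∈-map⁺; ∈-upTo⁺; ∈-cartesianProductWith⁺)
open import Data.List.Relation.Unary.Any using (here; there)
open import Data.List.Relation.Unary.All as All using (All; []; _∷_)
open import Data.List.Relation.Unary.Unique.Propositional using (Unique)
open import Data.List.Relation.Unary.AllPairs using ([]; _∷_)
open import Data.Vec using (Vec; []; _∷_; lookup; zipWith; sum)
open import Data.Vec.Properties using ([]=⇒lookup; lookup⇒[]=)
open import Data.Fin as Fin using (Fin; toℕ; fromℕ<; _↑ˡ_; _↑ʳ_; join; splitAt)
open import Data.Fin.Properties using (toℕ-fromℕ<; toℕ-injective; toℕ<n; ↑ʳ-injective; inject₁-injective; join-splitAt; splitAt-↑ˡ; splitAt-↑ʳ)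
open import Data.Fin.Subset.Properties using (⊆-antisym; ⊆⊤; ⊥⊆; x∈p∩q⁻; x∈p∪q⁺)
open import Data.Fin.Subset using (Subset; ∣_∣; _∈_; _∩_; _∪_) renaming (⊥ to ∅; ⊤ to full)
open import Function using (_∘_; _$_)
open import Data.Product using (Σ; _×_; _,_; ∃; proj₁; proj₂; uncurry)
open import Data.Sum using (_⊎_; inj₁; inj₂)
open import Data.Empty using (⊥; ⊥-elim)
open import Relation.Binary.PropositionalEquality
  using (_≡_; _≢_; refl; sym; trans; cong; cong₂; subst; subst₂; module ≡-Reasoning)
open import Data.Integer as ℤ using (ℤ)
import Data.Integer.Properties as ℤ
open import Data.Integer.DivMod using ([n/d]*d≤n)
open import Data.Rational as ℚ using (ℚ; mkℚ; floor; 0ℚ; ½; ↥_; ↧_)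
open import Data.Rational.Properties using (↥-*; ↧-*; normalize-coprime)
open import Data.Nat.Coprimality as Coprime using (1-coprimeTo)
open import Relation.Nullary using (Dec; yes; no)
open import Relation.Nullary.Decidable using (_×-dec_)

fromBool : Bool → ℕ
fromBool true = 1
fromBool false = 0

sumFrom : (ℕ → ℕ) → ℕ → ℕ → ℕ
sumFrom f a zero = 0
sumFrom f a (suc n) = f a + sumFrom f (suc a) n

sumFrom-shift : ∀ f a n → sumFrom (λ t → f (suc t)) a n ≡ sumFrom f (suc a) n
sumFrom-shift f a zero = refl
sumFrom-shift f a (suc n) = cong (f (suc a) +_) (sumFrom-shift f (suc a) n)

sumFrom-cong : ∀ f g a n → (∀ t → a ≤ t → t < a + n → f t ≡ g t) → sumFrom f a n ≡ sumFrom g a n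
sumFrom-cong f g a zero eq = refl
sumFrom-cong f g a (suc n) eq = cong₂ _+_ (eq a ≤-refl (m<m+n a (s≤s z≤n)))
  (sumFrom-cong f g (suc a) n (λ t a<t t<a+n → eq t (<⇒≤ a<t) (subst (t <_) (sym (+-suc a n)) t<a+n)))

sumFrom-distrib-+ : ∀ f g a n → sumFrom (λ t → f t + g t) a n ≡ sumFrom f a n + sumFrom g a n
sumFrom-distrib-+ f g a zero = refl
sumFrom-distrib-+ f g a (suc n) rewrite sumFrom-distrib-+ f g (suc a) n =
  swap (f a) (g a) (sumFrom f (suc a) n) (sumFrom g (suc a) n)
  where
  swap : ∀ x y z w → x + y + (z + w) ≡ x + z + (y + w)
  swap = solve-∀

sumFrom-split : ∀ f a n n' → sumFrom f a (n + n') ≡ sumFrom f a n + sumFrom f (a + n) n'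
sumFrom-split f a zero n' = cong (λ x → sumFrom f x n') (sym (+-identityʳ a))
sumFrom-split f a (suc n) n' rewrite sumFrom-split f (suc a) n n' | +-suc a n =
  sym (+-assoc (f a) _ _)

term≤sumFrom : ∀ f a n t → a ≤ t → t < a + n → f t ≤ sumFrom f a n
term≤sumFrom f a zero t a≤t t<a = ⊥-elim (<-irrefl refl (≤-trans t<a (subst (_≤ t) (sym (+-identityʳ a)) a≤t)))
term≤sumFrom f a (suc n) t a≤t t<a+n with m≤n⇒m<n∨m≡n a≤t
... | inj₂ refl = m≤m+n (f t) _
... | inj₁ a<t = ≤-trans (term≤sumFrom f (suc a) n t a<t (subst (t <_) (+-suc a n) t<a+n)) (m≤n+m _ (f a))

sumFrom-const-1 : ∀ a n → sumFrom (λ _ → 1) a n ≡ n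
sumFrom-const-1 a zero = refl
sumFrom-const-1 a (suc n) = cong suc (sumFrom-const-1 (suc a) n)

sumFrom-zero : ∀ f a n → (∀ t → a ≤ t → t < a + n → f t ≡ 0) → sumFrom f a n ≡ 0
sumFrom-zero f a n eq = trans (sumFrom-cong f (λ _ → 0) a n eq) (zeros a n)
  where
  zeros : ∀ a n → sumFrom (λ _ → 0) a n ≡ 0
  zeros a zero = refl
  zeros a (suc n) = zeros (suc a) n

-- at xs t is entry t of xs, false out of range; atU m S t and atV m S t read entry t of the
-- first and second half of S, i.e. whether u_t and v_t belong to S.
at : ∀ {n} → Vec Bool n → ℕ → Bool
at [] _ = false
at (x ∷ xs) zero = x
at (x ∷ xs) (suc t) = at xs t

atU : ∀ m {n} → Vec Bool (m + n) → ℕ → Bool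
atU zero _ _ = false
atU (suc m) (x ∷ xs) zero = x
atU (suc m) (x ∷ xs) (suc t) = atU m xs t

atV : ∀ m {n} → Vec Bool (m + n) → ℕ → Bool
atV zero xs t = at xs t
atV (suc m) (x ∷ xs) t = atV m xs t

∣∣≡sumFrom-at : ∀ {n} (xs : Vec Bool n) → ∣ xs ∣ ≡ sumFrom (fromBool ∘ at xs) 0 n
∣∣≡sumFrom-at [] = refl
∣∣≡sumFrom-at {suc n} (true ∷ xs) = cong suc (trans (∣∣≡sumFrom-at xs) (sumFrom-shift (fromBool ∘ at (true ∷ xs)) 0 n))
∣∣≡sumFrom-at {suc n} (false ∷ xs) = trans (∣∣≡sumFrom-at xs) (sumFrom-shift (fromBool ∘ at (false ∷ xs)) 0 n)

∣∣≡sumFrom-atU+atV : ∀ m {n} (S : Vec Bool (m + n)) →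
  ∣ S ∣ ≡ sumFrom (fromBool ∘ atU m S) 0 m + sumFrom (fromBool ∘ atV m S) 0 n
∣∣≡sumFrom-atU+atV zero S = ∣∣≡sumFrom-at S
∣∣≡sumFrom-atU+atV (suc m) {n} (x ∷ xs) = begin
  ∣ x ∷ xs ∣
    ≡⟨ ∣∷∣ x ⟩
  fromBool x + ∣ xs ∣
    ≡⟨ cong (fromBool x +_) (∣∣≡sumFrom-atU+atV m xs) ⟩
  fromBool x + (sumFrom (fromBool ∘ atU m xs) 0 m + V)
    ≡⟨ sym (+-assoc (fromBool x) _ V) ⟩
  fromBool x + sumFrom (fromBool ∘ atU m xs) 0 m + V
    ≡⟨ cong (λ z → fromBool x + z + V) (sumFrom-shift (fromBool ∘ atU (suc m) (x ∷ xs)) 0 m) ⟩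
  sumFrom (fromBool ∘ atU (suc m) (x ∷ xs)) 0 (suc m) + V ∎
  where
  open ≡-Reasoning
  V = sumFrom (fromBool ∘ atV m xs) 0 n
  ∣∷∣ : ∀ x → ∣ x ∷ xs ∣ ≡ fromBool x + ∣ xs ∣
  ∣∷∣ true = refl
  ∣∷∣ false = refl

lookup≡at : ∀ {n} (xs : Vec Bool n) (j : Fin n) → lookup xs j ≡ at xs (toℕ j)
lookup≡at (x ∷ xs) Fin.zero = refl
lookup≡at (x ∷ xs) (Fin.suc j) = lookup≡at xs j

lookup-↑ˡ≡atU : ∀ m {n} (S : Vec Bool (m + n)) (i : Fin m) → lookup S (i ↑ˡ n) ≡ atU m S (toℕ i)
lookup-↑ˡ≡atU (suc m) (x ∷ xs) Fin.zero = refl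
lookup-↑ˡ≡atU (suc m) (x ∷ xs) (Fin.suc i) = lookup-↑ˡ≡atU m xs i

lookup-↑ʳ≡atV : ∀ m {n} (S : Vec Bool (m + n)) (j : Fin n) → lookup S (m ↑ʳ j) ≡ atV m S (toℕ j)
lookup-↑ʳ≡atV zero S j = lookup≡at S j
lookup-↑ʳ≡atV (suc m) (x ∷ xs) j = lookup-↑ʳ≡atV m xs j

at-true⇒< : ∀ {n} (xs : Vec Bool n) t → at xs t ≡ true → t < n
at-true⇒< (x ∷ xs) zero _ = s≤s z≤n
at-true⇒< (x ∷ xs) (suc t) eq = s≤s (at-true⇒< xs t eq)

atU-true⇒< : ∀ m {n} (S : Vec Bool (m + n)) t → atU m S t ≡ true → t < m
atU-true⇒< (suc m) (x ∷ xs) zero _ = s≤s z≤n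
atU-true⇒< (suc m) (x ∷ xs) (suc t) eq = s≤s (atU-true⇒< m xs t eq)

atV-true⇒< : ∀ m {n} (S : Vec Bool (m + n)) t → atV m S t ≡ true → t < n
atV-true⇒< zero S t eq = at-true⇒< S t eq
atV-true⇒< (suc m) (x ∷ xs) t eq = atV-true⇒< m xs t eq

tabulateℕ : ∀ n → (ℕ → Bool) → Vec Bool n
tabulateℕ zero f = []
tabulateℕ (suc n) f = f 0 ∷ tabulateℕ n (f ∘ suc)

fromAtUV : ∀ m n → (ℕ → Bool) → (ℕ → Bool) → Vec Bool (m + n)
fromAtUV zero n f g = tabulateℕ n g
fromAtUV (suc m) n f g = f 0 ∷ fromAtUV m n (f ∘ suc) g

at-tabulateℕ : ∀ n f t → t < n → at (tabulateℕ n f) t ≡ f t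
at-tabulateℕ (suc n) f zero _ = refl
at-tabulateℕ (suc n) f (suc t) (s≤s t<n) = at-tabulateℕ n (f ∘ suc) t t<n

atU-fromAtUV : ∀ m n f g t → t < m → atU m (fromAtUV m n f g) t ≡ f t
atU-fromAtUV (suc m) n f g zero _ = refl
atU-fromAtUV (suc m) n f g (suc t) (s≤s t<m) = atU-fromAtUV m n (f ∘ suc) g t t<m

atV-fromAtUV : ∀ m n f g t → t < n → atV m (fromAtUV m n f g) t ≡ g t
atV-fromAtUV zero n f g t t<n = at-tabulateℕ n g t t<n
atV-fromAtUV (suc m) n f g t t<n = atV-fromAtUV m n (f ∘ suc) g t t<n

at-injective : ∀ {n} (xs ys : Vec Bool n) → (∀ t → at xs t ≡ at ys t) → xs ≡ ys
at-injective [] [] _ = refl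
at-injective (x ∷ xs) (y ∷ ys) eq = cong₂ _∷_ (eq 0) (at-injective xs ys (eq ∘ suc))

atUV-injective : ∀ m {n} (S T : Vec Bool (m + n)) →
  (∀ t → atU m S t ≡ atU m T t) → (∀ t → atV m S t ≡ atV m T t) → S ≡ T
atUV-injective zero S T _ eqV = at-injective S T eqV
atUV-injective (suc m) (x ∷ xs) (y ∷ ys) eqU eqV =
  cong₂ _∷_ (eqU 0) (atUV-injective m xs ys (eqU ∘ suc) eqV)

module _ (f : Bool → Bool → Bool) (f-ff : f false false ≡ false) where

  at-zipWith : ∀ {n} (xs ys : Vec Bool n) t → at (zipWith f xs ys) t ≡ f (at xs t) (at ys t)
  at-zipWith [] [] t = sym f-ff
  at-zipWith (x ∷ xs) (y ∷ ys) zero = refl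
  at-zipWith (x ∷ xs) (y ∷ ys) (suc t) = at-zipWith xs ys t

  atU-zipWith : ∀ m {n} (S T : Vec Bool (m + n)) t → atU m (zipWith f S T) t ≡ f (atU m S t) (atU m T t)
  atU-zipWith zero S T t = sym f-ff
  atU-zipWith (suc m) (x ∷ xs) (y ∷ ys) zero = refl
  atU-zipWith (suc m) (x ∷ xs) (y ∷ ys) (suc t) = atU-zipWith m xs ys t

  atV-zipWith : ∀ m {n} (S T : Vec Bool (m + n)) t → atV m (zipWith f S T) t ≡ f (atV m S t) (atV m T t)
  atV-zipWith zero S T t = at-zipWith S T t
  atV-zipWith (suc m) (x ∷ xs) (y ∷ ys) t = atV-zipWith m xs ys t

-- Heap numbering of the tree and the colouring read off a list of holes

IsChild : ℕ → ℕ → Set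
IsChild p c = (c ≡ 2 * p + 1) ⊎ (c ≡ 2 * p + 2)

isLeftChild : ℕ → Bool
isLeftChild 0 = true
isLeftChild 1 = false
isLeftChild (suc (suc t)) = isLeftChild t

suc-child-of-⌊/2⌋ : ∀ t → (isLeftChild t ≡ true × suc t ≡ 2 * ⌊ t /2⌋ + 1)
                         ⊎ (isLeftChild t ≡ false × suc t ≡ 2 * ⌊ t /2⌋ + 2)
suc-child-of-⌊/2⌋ 0 = inj₁ (refl , refl)
suc-child-of-⌊/2⌋ 1 = inj₂ (refl , refl)
suc-child-of-⌊/2⌋ (suc (suc t)) with suc-child-of-⌊/2⌋ t
... | inj₁ (l , eq) = inj₁ (l , trans (cong (2 +_) eq) (left (⌊ t /2⌋)))
  where
  left : ∀ h → 2 + (2 * h + 1) ≡ 2 * suc h + 1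
  left = solve-∀
... | inj₂ (l , eq) = inj₂ (l , trans (cong (2 +_) eq) (right (⌊ t /2⌋)))
  where
  right : ∀ h → 2 + (2 * h + 2) ≡ 2 * suc h + 2
  right = solve-∀

isChild-⌊/2⌋ : ∀ t → IsChild ⌊ t /2⌋ (suc t)
isChild-⌊/2⌋ t with suc-child-of-⌊/2⌋ t
... | inj₁ (_ , eq) = inj₁ eq
... | inj₂ (_ , eq) = inj₂ eq

isChild⇒⌊/2⌋ : ∀ p c → IsChild p c → Σ ℕ λ t → (c ≡ suc t) × (⌊ t /2⌋ ≡ p)
isChild⇒⌊/2⌋ p _ (inj₁ refl) = 2 * p , +-comm (2 * p) 1 , ⌊2p/2⌋ p
  where
  ⌊2p/2⌋ : ∀ p → ⌊ 2 * p /2⌋ ≡ p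
  ⌊2p/2⌋ zero = refl
  ⌊2p/2⌋ (suc p) rewrite +-suc p (p + 0) = cong suc (⌊2p/2⌋ p)
isChild⇒⌊/2⌋ p _ (inj₂ refl) = suc (2 * p) , +-comm (2 * p) 2 , ⌊2p+1/2⌋ p
  where
  ⌊2p+1/2⌋ : ∀ p → ⌊ suc (2 * p) /2⌋ ≡ p
  ⌊2p+1/2⌋ zero = refl
  ⌊2p+1/2⌋ (suc p) rewrite +-suc p (p + 0) = cong suc (⌊2p+1/2⌋ p)

Entry : Set
Entry = ℕ × Bool × Bool

lookupEntry : List Entry → ℕ → Maybe (Bool × Bool)
lookupEntry [] p = nothing
lookupEntry ((x , b) ∷ E) p with x ℕ.≟ p
... | yes _ = just b
... | no _ = lookupEntry E p

isHole : List Entry → ℕ → Bool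
isHole E t = is-just (lookupEntry E t)

childColour : Maybe (Bool × Bool) → Bool → Bool → Bool
childColour (just (l , r)) isLeft parentColour = if isLeft then l else r
childColour nothing isLeft parentColour = not parentColour

colourWithin : Bool → List Entry → ℕ → ℕ → Bool
colourWithin rb E zero t = rb
colourWithin rb E (suc f) zero = rb
colourWithin rb E (suc f) (suc t) =
  childColour (lookupEntry E ⌊ t /2⌋) (isLeftChild t) (colourWithin rb E f ⌊ t /2⌋)

colour : Bool → List Entry → ℕ → Bool
colour rb E t = colourWithin rb E t t

colourWithin-fuel : ∀ rb E f g t → t ≤ f → t ≤ g → colourWithin rb E f t ≡ colourWithin rb E g t
colourWithin-fuel rb E zero zero t _ _ = refl
colourWithin-fuel rb E zero (suc g) zero _ _ = refl
colourWithin-fuel rb E (suc f) zero zero _ _ = refl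
colourWithin-fuel rb E (suc f) (suc g) zero _ _ = refl
colourWithin-fuel rb E (suc f) (suc g) (suc t) (s≤s t≤f) (s≤s t≤g) =
  cong (childColour (lookupEntry E ⌊ t /2⌋) (isLeftChild t))
       (colourWithin-fuel rb E f g ⌊ t /2⌋ (≤-trans (⌊n/2⌋≤n t) t≤f) (≤-trans (⌊n/2⌋≤n t) t≤g))

colour-suc : ∀ rb E t →
  colour rb E (suc t) ≡ childColour (lookupEntry E ⌊ t /2⌋) (isLeftChild t) (colour rb E ⌊ t /2⌋)
colour-suc rb E t = cong (childColour (lookupEntry E ⌊ t /2⌋) (isLeftChild t))
  (colourWithin-fuel rb E t ⌊ t /2⌋ ⌊ t /2⌋ (⌊n/2⌋≤n t) ≤-refl)

colour-child : ∀ rb E p c → IsChild p c → isHole E p ≡ false → colour rb E c ≡ not (colour rb E p)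
colour-child rb E p c ch notHole with isChild⇒⌊/2⌋ p c ch
... | t , refl , refl = trans (colour-suc rb E t) (noEntry (lookupEntry E ⌊ t /2⌋) notHole)
  where
  noEntry : ∀ mb → is-just mb ≡ false → childColour mb (isLeftChild t) (colour rb E ⌊ t /2⌋) ≡ not (colour rb E ⌊ t /2⌋)
  noEntry nothing _ = refl

colour-false-[] : ∀ t → colour false [] t ≡ not (colour true [] t)
colour-false-[] t = flip t t
  where
  flip : ∀ f t → colourWithin false [] f t ≡ not (colourWithin true [] f t)
  flip zero t = refl
  flip (suc f) zero = refl
  flip (suc f) (suc t) = cong not (flip f ⌊ t /2⌋)

-- Independent sets of G_k in tree coordinates

module Coordinates (k : ℕ) where

  m : ℕ
  m = nodes k

  u v : Subset (n (G k)) → ℕ → Bool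
  u = atU m
  v = atV m

  record TreeIndependent (S : Subset (n (G k))) : Set where
    field
      not-uv : ∀ t → u S t ≡ true → v S t ≡ true → ⊥
      not-uu : ∀ p c → IsChild p c → u S p ≡ true → u S c ≡ true → ⊥
      not-vv : ∀ p c → IsChild p c → v S p ≡ true → v S c ≡ true → ⊥

  u-member : ∀ S t → u S t ≡ true → Σ (Fin m) λ a → toℕ a ≡ t × (a ↑ˡ m) ∈ S
  u-member S t eq = a , toℕ-fromℕ< t<m ,
    lookup⇒[]= (a ↑ˡ m) S (trans (lookup-↑ˡ≡atU m S a) (subst (λ z → u S z ≡ true) (sym (toℕ-fromℕ< t<m)) eq))
    where
    t<m = atU-true⇒< m S t eq
    a = fromℕ< t<m

  v-member : ∀ S t → v S t ≡ true → Σ (Fin m) λ a → toℕ a ≡ t × (m ↑ʳ a) ∈ S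
  v-member S t eq = a , toℕ-fromℕ< t<m ,
    lookup⇒[]= (m ↑ʳ a) S (trans (lookup-↑ʳ≡atV m S a) (subst (λ z → v S z ≡ true) (sym (toℕ-fromℕ< t<m)) eq))
    where
    t<m = atV-true⇒< m S t eq
    a = fromℕ< t<m

  adj-uv : ∀ a → Adj (G k) (a ↑ˡ m) (m ↑ʳ a)
  adj-uv a = subst₂ AdjSplit (sym (splitAt-↑ˡ m a m)) (sym (splitAt-↑ʳ m m a)) refl

  adj-uu : ∀ a b → Child a b → Adj (G k) (a ↑ˡ m) (b ↑ˡ m)
  adj-uu a b ch = subst₂ AdjSplit (sym (splitAt-↑ˡ m a m)) (sym (splitAt-↑ˡ m b m)) (inj₁ ch)

  adj-vv : ∀ a b → Child a b → Adj (G k) (m ↑ʳ a) (m ↑ʳ b)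
  adj-vv a b ch = subst₂ AdjSplit (sym (splitAt-↑ʳ m m a)) (sym (splitAt-↑ʳ m m b)) (inj₁ ch)

  independent⇒treeIndependent : ∀ S → Independent (G k) S → TreeIndependent S
  independent⇒treeIndependent S ind = record { not-uv = not-uv ; not-uu = not-uu ; not-vv = not-vv }
    where
    not-uv : ∀ t → u S t ≡ true → v S t ≡ true → ⊥
    not-uv t eu ev with u-member S t eu | v-member S t ev
    ... | a , refl , a∈S | b , b≡a , b∈S with toℕ-injective b≡a
    ...   | refl = ind _ _ a∈S b∈S (adj-uv a)
    not-uu : ∀ p c → IsChild p c → u S p ≡ true → u S c ≡ true → ⊥
    not-uu p c ch ep ec with u-member S p ep | u-member S c ec
    ... | a , refl , a∈S | b , refl , b∈S = ind _ _ a∈S b∈S (adj-uu a b ch)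
    not-vv : ∀ p c → IsChild p c → v S p ≡ true → v S c ≡ true → ⊥
    not-vv p c ch ep ec with v-member S p ep | v-member S c ec
    ... | a , refl , a∈S | b , refl , b∈S = ind _ _ a∈S b∈S (adj-vv a b ch)

  treeIndependent⇒independent : ∀ S → TreeIndependent S → Independent (G k) S
  treeIndependent⇒independent S ti i j i∈S j∈S adj = noEdge (splitAt m i) (splitAt m j)
      (trans (cong (lookup S) (join-splitAt m m i)) ([]=⇒lookup i∈S))
      (trans (cong (lookup S) (join-splitAt m m j)) ([]=⇒lookup j∈S)) adj
    where
    open TreeIndependent ti
    uS : ∀ a → lookup S (join m m (inj₁ a)) ≡ true → u S (toℕ a) ≡ true
    uS a eq = trans (sym (lookup-↑ˡ≡atU m S a)) eq
    vS : ∀ a → lookup S (join m m (inj₂ a)) ≡ true → v S (toℕ a) ≡ true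
    vS a eq = trans (sym (lookup-↑ʳ≡atV m S a)) eq
    noEdge : ∀ x y → lookup S (join m m x) ≡ true → lookup S (join m m y) ≡ true → AdjSplit x y → ⊥
    noEdge (inj₁ a) (inj₁ b) ea eb (inj₁ ch) = not-uu (toℕ a) (toℕ b) ch (uS a ea) (uS b eb)
    noEdge (inj₁ a) (inj₁ b) ea eb (inj₂ ch) = not-uu (toℕ b) (toℕ a) ch (uS b eb) (uS a ea)
    noEdge (inj₂ a) (inj₂ b) ea eb (inj₁ ch) = not-vv (toℕ a) (toℕ b) ch (vS a ea) (vS b eb)
    noEdge (inj₂ a) (inj₂ b) ea eb (inj₂ ch) = not-vv (toℕ b) (toℕ a) ch (vS b eb) (vS a ea)
    noEdge (inj₁ a) (inj₂ .a) ea eb refl = not-uv (toℕ a) (uS a ea) (vS a eb)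
    noEdge (inj₂ a) (inj₁ .a) ea eb refl = not-uv (toℕ a) (uS a eb) (vS a ea)

  hole : Subset (n (G k)) → ℕ → Bool
  hole S t = not (u S t) ∧ not (v S t)

  holeCount : Subset (n (G k)) → ℕ
  holeCount S = sumFrom (fromBool ∘ hole S) 0 m

  ∣∣+holeCount≡m : ∀ S → TreeIndependent S → ∣ S ∣ + holeCount S ≡ m
  ∣∣+holeCount≡m S ti = begin
    ∣ S ∣ + holeCount S
      ≡⟨ cong (_+ holeCount S) (∣∣≡sumFrom-atU+atV m S) ⟩
    sumFrom fu 0 m + sumFrom fv 0 m + holeCount S
      ≡⟨ cong (_+ holeCount S) (sym (sumFrom-distrib-+ fu fv 0 m)) ⟩
    sumFrom (λ t → fu t + fv t) 0 m + holeCount S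
      ≡⟨ sym (sumFrom-distrib-+ (λ t → fu t + fv t) (fromBool ∘ hole S) 0 m) ⟩
    sumFrom (λ t → fu t + fv t + fromBool (hole S t)) 0 m
      ≡⟨ sumFrom-cong _ _ 0 m (λ t _ _ → oneOfThree t) ⟩
    sumFrom (λ _ → 1) 0 m
      ≡⟨ sumFrom-const-1 0 m ⟩
    m ∎
    where
    open ≡-Reasoning
    fu = fromBool ∘ u S
    fv = fromBool ∘ v S
    oneOfThree : ∀ t → fu t + fv t + fromBool (hole S t) ≡ 1
    oneOfThree t with u S t in eu | v S t in ev
    ... | true | true = ⊥-elim (TreeIndependent.not-uv ti t eu ev)
    ... | true | false = refl
    ... | false | true = refl
    ... | false | false = refl

  ∣∣≤m : ∀ S → TreeIndependent S → ∣ S ∣ ≤ m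
  ∣∣≤m S ti = subst (∣ S ∣ ≤_) (∣∣+holeCount≡m S ti) (m≤m+n _ _)

  u-≥ : ∀ S t → m ≤ t → u S t ≡ false
  u-≥ S t m≤t with u S t in eu
  ... | true = ⊥-elim (<-irrefl refl (≤-trans (atU-true⇒< m S t eu) m≤t))
  ... | false = refl

  v-≥ : ∀ S t → m ≤ t → v S t ≡ false
  v-≥ S t m≤t with v S t in ev
  ... | true = ⊥-elim (<-irrefl refl (≤-trans (atV-true⇒< m S t ev) m≤t))
  ... | false = refl

  decode : Bool → List Entry → Subset (n (G k))
  decode rb E = fromAtUV m m (λ t → not (isHole E t) ∧ colour rb E t)
                             (λ t → not (isHole E t) ∧ not (colour rb E t))

  u-decode : ∀ rb E t → t < m → u (decode rb E) t ≡ (not (isHole E t) ∧ colour rb E t)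
  u-decode rb E t = atU-fromAtUV m m _ _ t

  v-decode : ∀ rb E t → t < m → v (decode rb E) t ≡ (not (isHole E t) ∧ not (colour rb E t))
  v-decode rb E t = atV-fromAtUV m m _ _ t

  decode-treeIndependent : ∀ rb E → TreeIndependent (decode rb E)
  decode-treeIndependent rb E = record { not-uv = not-uv ; not-uu = not-uu ; not-vv = not-vv }
    where
    S = decode rb E
    u-true : ∀ t → u S t ≡ true → (isHole E t ≡ false) × (colour rb E t ≡ true)
    u-true t eq with isHole E t | colour rb E t | trans (sym (u-decode rb E t (atU-true⇒< m S t eq))) eq
    ... | false | true | _ = refl , refl
    v-true : ∀ t → v S t ≡ true → (isHole E t ≡ false) × (colour rb E t ≡ false)
    v-true t eq with isHole E t | colour rb E t | trans (sym (v-decode rb E t (atV-true⇒< m S t eq))) eq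
    ... | false | false | _ = refl , refl
    not-uv : ∀ t → u S t ≡ true → v S t ≡ true → ⊥
    not-uv t eu ev with trans (sym (proj₂ (u-true t eu))) (proj₂ (v-true t ev))
    ... | ()
    not-uu : ∀ p c → IsChild p c → u S p ≡ true → u S c ≡ true → ⊥
    not-uu p c ch ep ec with u-true p ep | u-true c ec
    ... | notHole , cp | _ , cc with trans (sym cc) (trans (colour-child rb E p c ch notHole) (cong not cp))
    ...   | ()
    not-vv : ∀ p c → IsChild p c → v S p ≡ true → v S c ≡ true → ⊥
    not-vv p c ch ep ec with v-true p ep | v-true c ec
    ... | notHole , cp | _ , cc with trans (sym cc) (trans (colour-child rb E p c ch notHole) (cong not cp))
    ...   | ()

  holeEntries : Subset (n (G k)) → ℕ → ℕ → List Entry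
  holeEntries S a zero = []
  holeEntries S a (suc n) =
    if hole S a then (a , u S (2 * a + 1) , u S (2 * a + 2)) ∷ holeEntries S (suc a) n
                else holeEntries S (suc a) n

  lookupEntry-holeEntries-nothing : ∀ S a n p → hole S p ≡ false → lookupEntry (holeEntries S a n) p ≡ nothing
  lookupEntry-holeEntries-nothing S a zero p _ = refl
  lookupEntry-holeEntries-nothing S a (suc n) p notHole with hole S a in ha
  ... | false = lookupEntry-holeEntries-nothing S (suc a) n p notHole
  ... | true with a ℕ.≟ p
  ...   | no _ = lookupEntry-holeEntries-nothing S (suc a) n p notHole
  ...   | yes refl with trans (sym ha) notHole
  ...     | ()

  lookupEntry-holeEntries-just : ∀ S a n p → hole S p ≡ true → a ≤ p → p < a + n →
    lookupEntry (holeEntries S a n) p ≡ just (u S (2 * p + 1) , u S (2 * p + 2))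
  lookupEntry-holeEntries-just S a zero p _ a≤p p<a =
    ⊥-elim (<-irrefl refl (≤-trans p<a (subst (_≤ p) (sym (+-identityʳ a)) a≤p)))
  lookupEntry-holeEntries-just S a (suc n) p isH a≤p p<a+n with m≤n⇒m<n∨m≡n a≤p
  ... | inj₂ refl rewrite isH with a ℕ.≟ a
  ...   | yes _ = refl
  ...   | no a≢a = ⊥-elim (a≢a refl)
  lookupEntry-holeEntries-just S a (suc n) p isH a≤p p<a+n | inj₁ a<p with hole S a
  ... | false = lookupEntry-holeEntries-just S (suc a) n p isH a<p (subst (p <_) (+-suc a n) p<a+n)
  ... | true with a ℕ.≟ p
  ...   | yes refl = ⊥-elim (<-irrefl refl a<p)
  ...   | no _ = lookupEntry-holeEntries-just S (suc a) n p isH a<p (subst (p <_) (+-suc a n) p<a+n)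

  length-holeEntries : ∀ S a n → length (holeEntries S a n) ≡ sumFrom (fromBool ∘ hole S) a n
  length-holeEntries S a zero = refl
  length-holeEntries S a (suc n) with hole S a
  ... | true = cong suc (length-holeEntries S (suc a) n)
  ... | false = length-holeEntries S (suc a) n

  isHole-holeEntries : ∀ S t → t < m → isHole (holeEntries S 0 m) t ≡ hole S t
  isHole-holeEntries S t t<m with hole S t in isH
  ... | true rewrite lookupEntry-holeEntries-just S 0 m t isH z≤n t<m = refl
  ... | false rewrite lookupEntry-holeEntries-nothing S 0 m t isH = refl

  u-child-of-non-holes : ∀ S → TreeIndependent S → ∀ p c → IsChild p c →
    hole S p ≡ false → hole S c ≡ false → u S c ≡ not (u S p)
  u-child-of-non-holes S ti p c ch hp hc with u S p in up | u S c in uc | v S p in vp | v S c in vc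
  ... | true | true | _ | _ = ⊥-elim (TreeIndependent.not-uu ti p c ch up uc)
  ... | true | false | _ | _ = refl
  ... | false | true | _ | _ = refl
  ... | false | false | true | true = ⊥-elim (TreeIndependent.not-vv ti p c ch vp vc)
  ... | false | false | false | _ with hp
  ...   | ()
  u-child-of-non-holes S ti p c ch hp hc | false | false | true | false with hc
  ...   | ()

  colour-holeEntries : ∀ S → TreeIndependent S → ∀ t → t < m → hole S t ≡ false →
    colour (u S 0) (holeEntries S 0 m) t ≡ u S t
  colour-holeEntries S ti t = within t t ≤-refl
    where
    E = holeEntries S 0 m
    parent< : ∀ t → suc t < m → ⌊ t /2⌋ < m
    parent< t = <-trans (s≤s (⌊n/2⌋≤n t))
    within : ∀ f t → t ≤ f → t < m → hole S t ≡ false → colourWithin (u S 0) E f t ≡ u S t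
    within zero zero _ _ _ = refl
    within (suc f) zero _ _ _ = refl
    within (suc f) (suc t) (s≤s t≤f) t<m notHole with hole S ⌊ t /2⌋ in parentHole
    ... | true rewrite lookupEntry-holeEntries-just S 0 m ⌊ t /2⌋ parentHole z≤n (parent< t t<m)
          with suc-child-of-⌊/2⌋ t
    ...   | inj₁ (left , eq) rewrite left = sym (cong (u S) eq)
    ...   | inj₂ (right , eq) rewrite right = sym (cong (u S) eq)
    within (suc f) (suc t) (s≤s t≤f) t<m notHole | false
      rewrite lookupEntry-holeEntries-nothing S 0 m ⌊ t /2⌋ parentHole
            | within f ⌊ t /2⌋ (≤-trans (⌊n/2⌋≤n t) t≤f) (parent< t t<m) parentHole
      = sym (u-child-of-non-holes S ti ⌊ t /2⌋ (suc t) (isChild-⌊/2⌋ t) parentHole notHole)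

  decode-holeEntries : ∀ S → TreeIndependent S → decode (u S 0) (holeEntries S 0 m) ≡ S
  decode-holeEntries S ti = atUV-injective m _ _ sameU sameV
    where
    E = holeEntries S 0 m
    sameU : ∀ t → u (decode (u S 0) E) t ≡ u S t
    sameU t with t <? m
    ... | no t≮m = trans (u-≥ _ t (≮⇒≥ t≮m)) (sym (u-≥ S t (≮⇒≥ t≮m)))
    ... | yes t<m rewrite u-decode (u S 0) E t t<m | isHole-holeEntries S t t<m with hole S t in isH
    ...   | false = colour-holeEntries S ti t t<m isH
    ...   | true with u S t
    ...     | false = refl
    sameV : ∀ t → v (decode (u S 0) E) t ≡ v S t
    sameV t with t <? m
    ... | no t≮m = trans (v-≥ _ t (≮⇒≥ t≮m)) (sym (v-≥ S t (≮⇒≥ t≮m)))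
    ... | yes t<m rewrite v-decode (u S 0) E t t<m | isHole-holeEntries S t t<m with hole S t in isH
    ...   | false rewrite colour-holeEntries S ti t t<m isH = exactlyOne (u S t) (v S t) isH (TreeIndependent.not-uv ti t)
      where
      exactlyOne : ∀ a b → (not a ∧ not b) ≡ false → (a ≡ true → b ≡ true → ⊥) → not a ≡ b
      exactlyOne true true _ not-both = ⊥-elim (not-both refl refl)
      exactlyOne true false _ _ = refl
      exactlyOne false true _ _ = refl
    ...   | true with u S t | v S t
    ...     | false | false = refl

suc-nodes : ∀ k → suc (nodes k) ≡ 2 ^ (k + 1)
suc-nodes k = trans (+-comm 1 (nodes k)) (m∸n+n≡m (m^n>0 2 (k + 1)))

0<nodes : ∀ k → 0 < nodes k
0<nodes k = +-cancelˡ-< 1 0 (nodes k) (≤-trans (s≤s (s≤s z≤n)) (subst (2 ≤_) (sym (suc-nodes k)) 2≤2^k+1))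
  where
  2≤2^k+1 : 2 ≤ 2 ^ (k + 1)
  2≤2^k+1 rewrite +-comm k 1 = *-monoʳ-≤ 2 (m^n>0 2 k)

vertexCount : ∀ k → n (G k) ≡ 2 ^ (k + 2) ∸ 2
vertexCount k = begin
  nodes k + nodes k                          ≡⟨ cong (_∸ 1) (sym (+-suc (nodes k) (nodes k))) ⟩
  (suc (nodes k) + suc (nodes k)) ∸ 2        ≡⟨ cong (λ x → (x + x) ∸ 2) (suc-nodes k) ⟩
  (2 ^ (k + 1) + 2 ^ (k + 1)) ∸ 2            ≡⟨ cong (λ x → (2 ^ (k + 1) + x) ∸ 2) (sym (+-identityʳ _)) ⟩
  2 * 2 ^ (k + 1) ∸ 2                        ≡⟨ cong (λ x → 2 ^ x ∸ 2) (sym (+-suc k 1)) ⟩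
  2 ^ (k + 2) ∸ 2                            ∎
  where open ≡-Reasoning

module MaximumIndependentSets (k : ℕ) where
  open Coordinates k

  Iₖ Jₖ : Subset (n (G k))
  Iₖ = decode true []
  Jₖ = decode false []

  holeCount-decode-[] : ∀ rb → holeCount (decode rb []) ≡ 0
  holeCount-decode-[] rb = sumFrom-zero _ 0 m noHole
    where
    noHole : ∀ t → 0 ≤ t → t < m → fromBool (hole (decode rb []) t) ≡ 0
    noHole t _ t<m rewrite u-decode rb [] t t<m | v-decode rb [] t t<m with colour rb [] t
    ... | true = refl
    ... | false = refl

  ∣decode-[]∣ : ∀ rb → ∣ decode rb [] ∣ ≡ m
  ∣decode-[]∣ rb = begin
    ∣ decode rb [] ∣                                 ≡⟨ sym (+-identityʳ _) ⟩
    ∣ decode rb [] ∣ + 0                             ≡⟨ cong (∣ decode rb [] ∣ +_) (sym (holeCount-decode-[] rb)) ⟩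
    ∣ decode rb [] ∣ + holeCount (decode rb [])      ≡⟨ ∣∣+holeCount≡m _ (decode-treeIndependent rb []) ⟩
    m                                                ∎
    where open ≡-Reasoning

  decode-[]-maximum : ∀ rb → MaximumIndependent (G k) (decode rb [])
  decode-[]-maximum rb = treeIndependent⇒independent _ (decode-treeIndependent rb []) ,
    λ T indT → subst (∣ T ∣ ≤_) (sym (∣decode-[]∣ rb)) (∣∣≤m T (independent⇒treeIndependent T indT))

  maximum⇒∣∣≡m : ∀ S → MaximumIndependent (G k) S → ∣ S ∣ ≡ m
  maximum⇒∣∣≡m S (indS , maxS) = ≤-antisym (∣∣≤m S (independent⇒treeIndependent S indS))
    (subst (_≤ ∣ S ∣) (∣decode-[]∣ true) (maxS Iₖ (proj₁ (decode-[]-maximum true))))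

  independenceNumber≡m : ∀ a → IsIndependenceNumber (G k) a → a ≡ m
  independenceNumber≡m a (S , maxS , ∣S∣≡a) = trans (sym ∣S∣≡a) (maximum⇒∣∣≡m S maxS)

  maximum⇒decode-[] : ∀ S → MaximumIndependent (G k) S → decode (u S 0) [] ≡ S
  maximum⇒decode-[] S maxS@(indS , _) = subst (λ E → decode (u S 0) E ≡ S) noEntries (decode-holeEntries S ti)
    where
    ti = independent⇒treeIndependent S indS
    noHoles : holeCount S ≡ 0
    noHoles = +-cancelˡ-≡ m _ _ (begin
      m + holeCount S      ≡⟨ cong (_+ holeCount S) (sym (maximum⇒∣∣≡m S maxS)) ⟩
      ∣ S ∣ + holeCount S  ≡⟨ ∣∣+holeCount≡m S ti ⟩
      m                    ≡⟨ sym (+-identityʳ m) ⟩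
      m + 0                ∎)
      where open ≡-Reasoning
    noEntries : holeEntries S 0 m ≡ []
    noEntries with holeEntries S 0 m | length-holeEntries S 0 m
    ... | [] | _ = refl
    ... | _ ∷ _ | len rewrite noHoles with len
    ...   | ()

  maximum⇒Iₖ⊎Jₖ : ∀ S → MaximumIndependent (G k) S → (S ≡ Iₖ) ⊎ (S ≡ Jₖ)
  maximum⇒Iₖ⊎Jₖ S maxS with u S 0 | maximum⇒decode-[] S maxS
  ... | true | eq = inj₁ (sym eq)
  ... | false | eq = inj₂ (sym eq)

  Iₖ≢Jₖ : Iₖ ≢ Jₖ
  Iₖ≢Jₖ Iₖ≡Jₖ with trans (sym (u-decode true [] 0 (0<nodes k))) (trans (cong (λ S → u S 0) Iₖ≡Jₖ) (u-decode false [] 0 (0<nodes k)))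
  ... | ()

  lookup-Jₖ : ∀ x → lookup Jₖ x ≡ not (lookup Iₖ x)
  lookup-Jₖ x = subst (λ y → lookup Jₖ y ≡ not (lookup Iₖ y)) (join-splitAt m m x) (onHalves (splitAt m x))
    where
    onHalves : ∀ y → lookup Jₖ (join m m y) ≡ not (lookup Iₖ (join m m y))
    onHalves (inj₁ a) rewrite lookup-↑ˡ≡atU m Jₖ a | lookup-↑ˡ≡atU m Iₖ a
                            | u-decode false [] (toℕ a) (toℕ<n a) | u-decode true [] (toℕ a) (toℕ<n a)
      = colour-false-[] (toℕ a)
    onHalves (inj₂ a) rewrite lookup-↑ʳ≡atV m Jₖ a | lookup-↑ʳ≡atV m Iₖ a
                            | v-decode false [] (toℕ a) (toℕ<n a) | v-decode true [] (toℕ a) (toℕ<n a)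
      = cong not (colour-false-[] (toℕ a))

  Iₖ∩Jₖ≡∅ : Iₖ ∩ Jₖ ≡ ∅
  Iₖ∩Jₖ≡∅ = ⊆-antisym (λ {x} x∈Iₖ∩Jₖ → ⊥-elim (notBoth x (x∈p∩q⁻ Iₖ Jₖ x∈Iₖ∩Jₖ))) ⊥⊆
    where
    notBoth : ∀ x → x ∈ Iₖ × x ∈ Jₖ → ⊥
    notBoth x (x∈Iₖ , x∈Jₖ) with lookup Iₖ x | []=⇒lookup x∈Iₖ | lookup-Jₖ x | []=⇒lookup x∈Jₖ
    ... | true | _ | Jₖ≡false | Jₖ≡true with trans (sym Jₖ≡false) Jₖ≡true
    ...   | ()

  Iₖ∪Jₖ≡full : Iₖ ∪ Jₖ ≡ full
  Iₖ∪Jₖ≡full = ⊆-antisym ⊆⊤ (λ {x} _ → x∈p∪q⁺ (∈Iₖ⊎∈Jₖ x))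
    where
    ∈Iₖ⊎∈Jₖ : ∀ x → x ∈ Iₖ ⊎ x ∈ Jₖ
    ∈Iₖ⊎∈Jₖ x with lookup Iₖ x in Iₖ[x]
    ... | true = inj₁ (lookup⇒[]= x Iₖ Iₖ[x])
    ... | false = inj₂ (lookup⇒[]= x Jₖ (trans (lookup-Jₖ x) (cong not Iₖ[x])))

-- Counting independent sets of size α − d

module _ {A : Set} where

  remove : ∀ {x : A} (M : List A) → x ∈ˡ M → List A
  remove (y ∷ M) (here _) = M
  remove (y ∷ M) (there x∈M) = y ∷ remove M x∈M

  length-remove : ∀ {x : A} (M : List A) (x∈M : x ∈ˡ M) → suc (length (remove M x∈M)) ≡ length M
  length-remove (y ∷ M) (here _) = refl
  length-remove (y ∷ M) (there x∈M) = cong suc (length-remove M x∈M)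

  ∈-remove : ∀ {x y : A} (M : List A) (x∈M : x ∈ˡ M) → y ∈ˡ M → y ≢ x → y ∈ˡ remove M x∈M
  ∈-remove (z ∷ M) (here refl) (here refl) y≢x = ⊥-elim (y≢x refl)
  ∈-remove (z ∷ M) (here refl) (there y∈M) _ = y∈M
  ∈-remove (z ∷ M) (there x∈M) (here refl) _ = here refl
  ∈-remove (z ∷ M) (there x∈M) (there y∈M) y≢x = there (∈-remove M x∈M y∈M y≢x)

  Unique-⊆⇒length≤ : (L M : List A) → Unique L → (∀ {x} → x ∈ˡ L → x ∈ˡ M) → length L ≤ length M
  Unique-⊆⇒length≤ [] M _ _ = z≤n
  Unique-⊆⇒length≤ (x ∷ L) M (x∉L ∷ uniqueL) L⊆M =
    subst (suc (length L) ≤_) (length-remove M x∈M)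
      (s≤s (Unique-⊆⇒length≤ L (remove M x∈M) uniqueL
        (λ y∈L → ∈-remove M x∈M (L⊆M (there y∈L)) (λ y≡x → All.lookup x∉L y∈L (sym y≡x)))))
    where
    x∈M = L⊆M (here refl)

  words : List A → ℕ → List (List A)
  words M zero = [] ∷ []
  words M (suc d) = cartesianProductWith _∷_ M (words M d)

  length-cartesianProductWith : ∀ {B C : Set} (f : A → B → C) xs ys →
    length (cartesianProductWith f xs ys) ≡ length xs * length ys
  length-cartesianProductWith f [] ys = refl
  length-cartesianProductWith f (x ∷ xs) ys = trans (length-++ (map (f x) ys))
    (cong₂ _+_ (length-map (f x) ys) (length-cartesianProductWith f xs ys))

  length-words : ∀ M d → length (words M d) ≡ length M ^ d
  length-words M zero = refl
  length-words M (suc d) = trans (length-cartesianProductWith _∷_ M (words M d)) (cong (length M *_) (length-words M d))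

  ∈-words : ∀ M (xs : List A) → All (_∈ˡ M) xs → xs ∈ˡ words M (length xs)
  ∈-words M [] _ = here refl
  ∈-words M (x ∷ xs) (x∈M ∷ xs⊆M) = ∈-cartesianProductWith⁺ _∷_ x∈M (∈-words M xs xs⊆M)

bools : List Bool
bools = true ∷ false ∷ []

∈-bools : ∀ b → b ∈ˡ bools
∈-bools true = here refl
∈-bools false = there (here refl)

^-distrib-* : ∀ a b d → (a * b) ^ d ≡ a ^ d * b ^ d
^-distrib-* a b zero = refl
^-distrib-* a b (suc d) rewrite ^-distrib-* a b d = swap a b (a ^ d) (b ^ d)
  where
  swap : ∀ a b x y → a * b * (x * y) ≡ a * x * (b * y)
  swap = solve-∀

2*[m*4]^d≡2^[2d+1]*m^d : ∀ m d → 2 * (m * (2 * 2)) ^ d ≡ 2 ^ (2 * d + 1) * m ^ d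
2*[m*4]^d≡2^[2d+1]*m^d m d = begin
  2 * (m * 4) ^ d             ≡⟨ cong (2 *_) (^-distrib-* m 4 d) ⟩
  2 * (m ^ d * 4 ^ d)         ≡⟨ cong (λ x → 2 * (m ^ d * x)) (^-*-assoc 2 2 d) ⟩
  2 * (m ^ d * 2 ^ (2 * d))   ≡⟨ rearrange (m ^ d) (2 ^ (2 * d)) ⟩
  2 ^ (2 * d) * 2 * m ^ d     ≡⟨ cong (_* m ^ d) (sym (^-distribˡ-+-* 2 (2 * d) 1)) ⟩
  2 ^ (2 * d + 1) * m ^ d     ∎
  where
  open ≡-Reasoning
  rearrange : ∀ x y → 2 * (x * y) ≡ y * 2 * x
  rearrange = solve-∀

module IndependentSetsOfGivenSize (k : ℕ) where
  open Coordinates k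
  open MaximumIndependentSets k using (independenceNumber≡m)

  entries : List Entry
  entries = cartesianProduct (upTo m) (cartesianProduct bools bools)

  codes : ℕ → List (Bool × List Entry)
  codes d = cartesianProduct bools (words entries d)

  length-codes : ∀ d → length (codes d) ≡ 2 ^ (2 * d + 1) * m ^ d
  length-codes d = begin
    length (codes d)                          ≡⟨ length-cartesianProductWith _,_ bools (words entries d) ⟩
    2 * length (words entries d)              ≡⟨ cong (2 *_) (length-words entries d) ⟩
    2 * length entries ^ d                    ≡⟨ cong (λ x → 2 * x ^ d) length-entries ⟩
    2 * (m * (2 * 2)) ^ d                     ≡⟨ 2*[m*4]^d≡2^[2d+1]*m^d m d ⟩
    2 ^ (2 * d + 1) * m ^ d                   ∎
    where
    open ≡-Reasoning
    length-entries : length entries ≡ m * (2 * 2)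
    length-entries = trans (length-cartesianProductWith _,_ (upTo m) _)
      (cong₂ _*_ (length-upTo m) (length-cartesianProductWith _,_ bools bools))

  holeEntries-bounded : ∀ S a n → a + n ≤ m → All (λ e → proj₁ e < m) (holeEntries S a n)
  holeEntries-bounded S a zero _ = []
  holeEntries-bounded S a (suc n) a+1+n≤m with hole S a
  ... | true = <-≤-trans (m<m+n a (s≤s z≤n)) a+1+n≤m ∷ holeEntries-bounded S (suc a) n (subst (_≤ m) (+-suc a n) a+1+n≤m)
  ... | false = holeEntries-bounded S (suc a) n (subst (_≤ m) (+-suc a n) a+1+n≤m)

  holeEntries⊆entries : ∀ S → All (_∈ˡ entries) (holeEntries S 0 m)
  holeEntries⊆entries S = All.map (λ {(t , l , r)} t<m →
      ∈-cartesianProductWith⁺ _,_ (∈-upTo⁺ t<m) (∈-cartesianProductWith⁺ _,_ (∈-bools l) (∈-bools r)))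
    (holeEntries-bounded S 0 m ≤-refl)

  ∈-decoded-codes : ∀ d S → Independent (G k) S → ∣ S ∣ + d ≡ m → S ∈ˡ map (uncurry decode) (codes d)
  ∈-decoded-codes d S indS ∣S∣+d≡m = subst (_∈ˡ map (uncurry decode) (codes d)) (decode-holeEntries S ti)
      (∈-map⁺ (uncurry decode) (∈-cartesianProductWith⁺ _,_ (∈-bools (u S 0))
        (subst (λ d → holeEntries S 0 m ∈ˡ words entries d) d-entries
          (∈-words entries (holeEntries S 0 m) (holeEntries⊆entries S)))))
    where
    ti = independent⇒treeIndependent S indS
    d-entries : length (holeEntries S 0 m) ≡ d
    d-entries = trans (length-holeEntries S 0 m)
      (+-cancelˡ-≡ ∣ S ∣ _ _ (trans (∣∣+holeCount≡m S ti) (sym ∣S∣+d≡m)))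

  setsOfSize-bound : ∀ d a → IsIndependenceNumber (G k) a →
    (L : List (Subset (n (G k)))) → Unique L →
    All (λ S → Independent (G k) S × (∣ S ∣ + d ≡ a)) L →
    length L ≤ 2 ^ (2 * d + 1) * a ^ d
  setsOfSize-bound d a isα L uniqueL allOfSize rewrite independenceNumber≡m a isα =
    subst (length L ≤_) (trans (length-map (uncurry decode) (codes d)) (length-codes d))
      (Unique-⊆⇒length≤ L _ uniqueL
        (λ S∈L → let indS , ∣S∣+d≡m = All.lookup allOfSize S∈L in ∈-decoded-codes d _ indS ∣S∣+d≡m))

-- Reconfiguration paths

lookup≤sum : ∀ {n} (xs : Vec ℕ n) i → lookup xs i ≤ sum xs
lookup≤sum (x ∷ xs) Fin.zero = m≤m+n x (sum xs)
lookup≤sum (x ∷ xs) (Fin.suc i) = ≤-trans (lookup≤sum xs i) (m≤n+m (sum xs) x)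

sum≤lookup⇒others≡0 : ∀ {n} (xs : Vec ℕ n) i → sum xs ≤ lookup xs i → ∀ j → j ≢ i → lookup xs j ≡ 0
sum≤lookup⇒others≡0 (x ∷ xs) Fin.zero _ Fin.zero j≢i = ⊥-elim (j≢i refl)
sum≤lookup⇒others≡0 (x ∷ xs) Fin.zero x+xs≤x (Fin.suc j) _ =
  n≤0⇒n≡0 (≤-trans (lookup≤sum xs j) (+-cancelˡ-≤ x (sum xs) 0 (subst (x + sum xs ≤_) (sym (+-identityʳ x)) x+xs≤x)))
sum≤lookup⇒others≡0 (x ∷ xs) (Fin.suc i) x+xs≤xsᵢ Fin.zero _ =
  n≤0⇒n≡0 (+-cancelʳ-≤ (sum xs) x 0 (≤-trans x+xs≤xsᵢ (lookup≤sum xs i)))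
sum≤lookup⇒others≡0 (x ∷ xs) (Fin.suc i) x+xs≤xsᵢ (Fin.suc j) j≢i =
  sum≤lookup⇒others≡0 xs i (m+n≤o⇒n≤o x x+xs≤xsᵢ) j (j≢i ∘ cong Fin.suc)

other₁ other₂ : Fin 3 → Fin 3
other₁ Fin.zero = Fin.suc Fin.zero
other₁ (Fin.suc _) = Fin.zero
other₂ Fin.zero = Fin.suc (Fin.suc Fin.zero)
other₂ (Fin.suc Fin.zero) = Fin.suc (Fin.suc Fin.zero)
other₂ (Fin.suc (Fin.suc Fin.zero)) = Fin.suc Fin.zero

other₁≢ : ∀ κ → other₁ κ ≢ κ
other₁≢ Fin.zero ()
other₁≢ (Fin.suc _) ()

other₂≢ : ∀ κ → other₂ κ ≢ κ
other₂≢ Fin.zero ()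
other₂≢ (Fin.suc Fin.zero) ()
other₂≢ (Fin.suc (Fin.suc Fin.zero)) ()

other₁≢other₂ : ∀ κ → other₁ κ ≢ other₂ κ
other₁≢other₂ Fin.zero ()
other₁≢other₂ (Fin.suc Fin.zero) ()
other₁≢other₂ (Fin.suc (Fin.suc Fin.zero)) ()

module ThreeSwitches
  (Before After Busy : Fin 3 → ℕ → Set) (s t : ℕ)
  (before-idle : ∀ κ i → Before κ i → Busy κ i → ⊥)
  (after-idle : ∀ κ i → After κ i → Busy κ i → ⊥)
  (busy-between : ∀ κ a b → s ≤ a → a ≤ b → b ≤ t → Before κ a → After κ b →
                  Σ ℕ λ i → a ≤ i × i ≤ b × Busy κ i)
  (others-agree : ∀ κ i → s ≤ i → i ≤ t → Busy κ i →
                  (∀ κ' → κ' ≢ κ → Before κ' i) ⊎ (∀ κ' → κ' ≢ κ → After κ' i))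
  (all-after : ∀ κ → After κ t) where

  Stuck : ℕ → Set
  Stuck c = s ≤ c → c ≤ t → ∀ x y → x ≢ y → Before x c → Before y c → ⊥

  -- Two switches x, y are Before at c. Chasing back and forth, the busy time of one of them (which
  -- exists as it is After at the end) sees the other two switches agree: if they are Before,
  -- we are in the same situation later; if After, the other one of x, y has an earlier busy time.
  stuck-step : ∀ c → (∀ e → c < e → e ≤ t → Stuck e) → Stuck c
  stuck-step c later s≤c c≤t x y x≢y before-x before-y = chase t c≤t ≤-refl x y x≢y before-x before-y (all-after x)
    where
    Chase : ℕ → Set
    Chase d = c ≤ d → d ≤ t → ∀ x y → x ≢ y → Before x c → Before y c → After x d → ⊥
    chase : ∀ d → Chase d
    chase = <-rec Chase go
      where
      go : ∀ d → (∀ {d'} → d' < d → Chase d') → Chase d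
      go d earlier c≤d d≤t x y x≢y before-x before-y after-x
        with busy-between x c d s≤c c≤d d≤t before-x after-x
      ... | e , c≤e , e≤d , busy with others-agree x e (≤-trans s≤c c≤e) (≤-trans e≤d d≤t) busy
      ...   | inj₁ before = later e c<e (≤-trans e≤d d≤t) (≤-trans s≤c c≤e) (≤-trans e≤d d≤t)
                (other₁ x) (other₂ x) (other₁≢other₂ x) (before (other₁ x) (other₁≢ x)) (before (other₂ x) (other₂≢ x))
        where
        c<e = ≤∧≢⇒< c≤e (λ c≡e → before-idle x e (subst (Before x) c≡e before-x) busy)
      ...   | inj₂ after = earlier e<d c≤e (≤-trans e≤d d≤t) y x (x≢y ∘ sym) before-y before-x (after y (x≢y ∘ sym))
        where
        e<d = ≤∧≢⇒< e≤d (λ e≡d → after-idle x e (subst (After x) (sym e≡d) after-x) busy)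

  stuck : ∀ c → Stuck c
  stuck c = <-rec (λ δ → ∀ c → t ∸ c ≡ δ → Stuck c) step (t ∸ c) c refl
    where
    step : ∀ δ → (∀ {δ'} → δ' < δ → ∀ c → t ∸ c ≡ δ' → Stuck c) → ∀ c → t ∸ c ≡ δ → Stuck c
    step δ rec c t∸c≡δ = stuck-step c (λ e c<e e≤t → rec (subst (t ∸ e <_) t∸c≡δ (∸-monoʳ-< c<e e≤t)) e refl)

  not-all-before : s ≤ t → (∀ κ → Before κ s) → ⊥
  not-all-before s≤t all-before =
    stuck s ≤-refl s≤t (other₁ Fin.zero) (other₂ Fin.zero) (λ ()) (all-before _) (all-before _)

subtreeSum : (ℕ → ℕ) → ℕ → ℕ → ℕ
subtreeSum f r zero = f r
subtreeSum f r (suc j) = f r + subtreeSum f (2 * r + 1) j + subtreeSum f (2 * r + 2) j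

root≤subtreeSum : ∀ f r j → f r ≤ subtreeSum f r j
root≤subtreeSum f r zero = ≤-refl
root≤subtreeSum f r (suc j) = ≤-trans (m≤m+n (f r) _) (m≤m+n _ _)

firstDescendant : ℕ → ℕ → ℕ
firstDescendant r zero = r
firstDescendant r (suc j) = firstDescendant (2 * r + 1) j

suc-firstDescendant : ∀ r j → suc (firstDescendant r j) ≡ suc r * 2 ^ j
suc-firstDescendant r zero = sym (*-identityʳ (suc r))
suc-firstDescendant r (suc j) = trans (suc-firstDescendant (2 * r + 1) j) (regroup r (2 ^ j))
  where
  regroup : ∀ r x → suc (2 * r + 1) * x ≡ suc r * (2 * x)
  regroup = solve-∀

firstDescendant-suc : ∀ r j → firstDescendant (suc r) j ≡ firstDescendant r j + 2 ^ j
firstDescendant-suc r j = suc-injective (begin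
  suc (firstDescendant (suc r) j)     ≡⟨ suc-firstDescendant (suc r) j ⟩
  2 ^ j + suc r * 2 ^ j               ≡⟨ cong (2 ^ j +_) (sym (suc-firstDescendant r j)) ⟩
  2 ^ j + suc (firstDescendant r j)   ≡⟨ +-comm (2 ^ j) _ ⟩
  suc (firstDescendant r j + 2 ^ j)   ∎)
  where open ≡-Reasoning

descendantSum : (ℕ → ℕ) → ℕ → ℕ → ℕ
descendantSum f r j = sumFrom f (firstDescendant r j) (2 ^ j)

descendantSum-suc : ∀ f r j → descendantSum f r (suc j) ≡ descendantSum f (2 * r + 1) j + descendantSum f (2 * r + 2) j
descendantSum-suc f r j = begin
  sumFrom f a (2 ^ j + (2 ^ j + 0))       ≡⟨ cong (sumFrom f a ∘ (2 ^ j +_)) (+-identityʳ (2 ^ j)) ⟩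
  sumFrom f a (2 ^ j + 2 ^ j)             ≡⟨ sumFrom-split f a (2 ^ j) (2 ^ j) ⟩
  sumFrom f a (2 ^ j) + sumFrom f (a + 2 ^ j) (2 ^ j)
    ≡⟨ cong (λ x → sumFrom f a (2 ^ j) + sumFrom f x (2 ^ j))
            (trans (sym (firstDescendant-suc (2 * r + 1) j)) (cong (λ x → firstDescendant x j) (sym (+-suc (2 * r) 1)))) ⟩
  descendantSum f (2 * r + 1) j + descendantSum f (2 * r + 2) j ∎
  where
  open ≡-Reasoning
  a = firstDescendant (2 * r + 1) j

levelSums : (ℕ → ℕ) → ℕ → ℕ → ℕ
levelSums f r zero = descendantSum f r 0
levelSums f r (suc j) = levelSums f r j + descendantSum f r (suc j)

levelSums-suc : ∀ f r j → levelSums f r (suc j) ≡ f r + levelSums f (2 * r + 1) j + levelSums f (2 * r + 2) j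
levelSums-suc f r zero rewrite descendantSum-suc f r 0 = regroup (f r) (f (2 * r + 1)) (f (2 * r + 2))
  where
  regroup : ∀ a b c → a + 0 + (b + 0 + (c + 0)) ≡ a + (b + 0) + (c + 0)
  regroup = solve-∀
levelSums-suc f r (suc j) rewrite levelSums-suc f r j | descendantSum-suc f r (suc j) =
  regroup (f r) (levelSums f (2 * r + 1) j) (levelSums f (2 * r + 2) j)
          (descendantSum f (2 * r + 1) (suc j)) (descendantSum f (2 * r + 2) (suc j))
  where
  regroup : ∀ a b c d e → a + b + c + (d + e) ≡ a + (b + d) + (c + e)
  regroup = solve-∀

subtreeSum≡levelSums : ∀ f r j → subtreeSum f r j ≡ levelSums f r j
subtreeSum≡levelSums f r zero = sym (+-identityʳ (f r))
subtreeSum≡levelSums f r (suc j) =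
  trans (cong₂ (λ x y → f r + x + y) (subtreeSum≡levelSums f (2 * r + 1) j) (subtreeSum≡levelSums f (2 * r + 2) j))
        (sym (levelSums-suc f r j))

subtreeSum-root≡sumFrom : ∀ f k → subtreeSum f 0 k ≡ sumFrom f 0 (nodes k)
subtreeSum-root≡sumFrom f k = trans (subtreeSum≡levelSums f 0 k) (levels k)
  where
  firstDescendant-root : ∀ j → firstDescendant 0 (suc j) ≡ nodes j
  firstDescendant-root j = suc-injective (trans (suc-firstDescendant 0 (suc j))
    (trans (+-identityʳ (2 ^ suc j)) (trans (cong (2 ^_) (+-comm 1 j)) (sym (suc-nodes j)))))
  nodes-suc : ∀ j → nodes (suc j) ≡ nodes j + 2 ^ suc j
  nodes-suc j = suc-injective (begin
    suc (nodes (suc j))          ≡⟨ suc-nodes (suc j) ⟩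
    2 ^ (suc j + 1)              ≡⟨ cong (λ x → 2 ^ x + (2 ^ x + 0)) (+-comm j 1) ⟩
    2 ^ suc j + (2 ^ suc j + 0)  ≡⟨ cong (2 ^ suc j +_) (trans (+-identityʳ _) (cong (2 ^_) (+-comm 1 j))) ⟩
    2 ^ suc j + 2 ^ (j + 1)      ≡⟨ cong (2 ^ suc j +_) (sym (suc-nodes j)) ⟩
    2 ^ suc j + suc (nodes j)    ≡⟨ +-comm (2 ^ suc j) _ ⟩
    suc (nodes j + 2 ^ suc j)    ∎)
    where open ≡-Reasoning
  levels : ∀ j → levelSums f 0 j ≡ sumFrom f 0 (nodes j)
  levels zero = refl
  levels (suc j) = begin
    levelSums f 0 j + sumFrom f (firstDescendant 0 (suc j)) (2 ^ suc j)
      ≡⟨ cong₂ (λ x y → x + sumFrom f y (2 ^ suc j)) (levels j) (firstDescendant-root j) ⟩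
    sumFrom f 0 (nodes j) + sumFrom f (nodes j) (2 ^ suc j)
      ≡⟨ sym (sumFrom-split f 0 (nodes j) (2 ^ suc j)) ⟩
    sumFrom f 0 (nodes j + 2 ^ suc j)
      ≡⟨ cong (sumFrom f 0) (sym (nodes-suc j)) ⟩
    sumFrom f 0 (nodes (suc j)) ∎
    where open ≡-Reasoning

holeIndicator : Maybe Bool → ℕ
holeIndicator nothing = 1
holeIndicator (just _) = 0

holeIndicator≡0 : ∀ x → holeIndicator x ≡ 0 → Σ Bool λ b → x ≡ just b
holeIndicator≡0 (just b) _ = b , refl

module ColourSwitching (p : ℕ) (state : ℕ → ℕ → Maybe Bool)
  (alternating : ∀ i x y b b' → IsChild x y → state i x ≡ just b → state i y ≡ just b' → b' ≡ not b)
  (no-swap : ∀ i x b → i < p → state i x ≡ just b → state (suc i) x ≡ just (not b) → ⊥) where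

  Alternating : ℕ → ℕ → ℕ → Bool → Set
  Alternating i r zero b = state i r ≡ just b
  Alternating i r (suc j) b =
    state i r ≡ just b × Alternating i (2 * r + 1) j (not b) × Alternating i (2 * r + 2) j (not b)

  holes : ℕ → ℕ → ℕ → ℕ
  holes i = subtreeSum (holeIndicator ∘ state i)

  Alternating-root : ∀ i r j b → Alternating i r j b → state i r ≡ just b
  Alternating-root i r zero b root = root
  Alternating-root i r (suc j) b (root , _) = root

  Alternating⇒holes≡0 : ∀ i r j b → Alternating i r j b → holes i r j ≡ 0
  Alternating⇒holes≡0 i r zero b root rewrite root = refl
  Alternating⇒holes≡0 i r (suc j) b (root , left , right)
    rewrite root | Alternating⇒holes≡0 i (2 * r + 1) j (not b) left | Alternating⇒holes≡0 i (2 * r + 2) j (not b) right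
    = refl

  child-colour : ∀ i x y b → IsChild x y → state i x ≡ just b → holeIndicator (state i y) ≡ 0 →
    state i y ≡ just (not b)
  child-colour i x y b ch x-b y-coloured with holeIndicator≡0 (state i y) y-coloured
  ... | b' , y-b' = trans y-b' (cong just (alternating i x y b b' ch x-b y-b'))

  holes≡0⇒Alternating : ∀ i r j b → holes i r j ≡ 0 → state i r ≡ just b → Alternating i r j b
  holes≡0⇒Alternating i r zero b _ root = root
  holes≡0⇒Alternating i r (suc j) b noHoles root =
    root , below (2 * r + 1) (inj₁ refl) left≡0 , below (2 * r + 2) (inj₂ refl) right≡0
    where
    children≡0 = m+n≡0⇒n≡0 (holeIndicator (state i r)) (trans (sym (+-assoc (holeIndicator (state i r)) (holes i (2 * r + 1) j) _)) noHoles)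
    left≡0 = m+n≡0⇒m≡0 (holes i (2 * r + 1) j) children≡0
    right≡0 = m+n≡0⇒n≡0 (holes i (2 * r + 1) j) children≡0
    below : ∀ c → IsChild r c → holes i c j ≡ 0 → Alternating i c j (not b)
    below c ch c≡0 = holes≡0⇒Alternating i c j (not b) c≡0
      (child-colour i r c b ch root (n≤0⇒n≡0 (≤-trans (root≤subtreeSum _ c j) (≤-reflexive c≡0))))

  recolouring⇒hole : ∀ r b s t → s ≤ t → t ≤ p → state s r ≡ just b → state t r ≡ just (not b) →
    Σ ℕ λ i → s ≤ i × i ≤ t × state i r ≡ nothing
  recolouring⇒hole r b s zero z≤n _ s-b t-¬b = ⊥-elim (not-¬ refl (just-injective (trans (sym s-b) t-¬b)))
  recolouring⇒hole r b s (suc t) s≤1+t 1+t≤p s-b t-¬b with m≤n⇒m<n∨m≡n s≤1+t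
  ... | inj₂ refl = ⊥-elim (not-¬ refl (just-injective (trans (sym s-b) t-¬b)))
  recolouring⇒hole r b s (suc t) s≤1+t 1+t≤p s-b t-¬b | inj₁ (s≤s s≤t) with state t r in t-state
  ... | nothing = t , s≤t , n≤1+n t , t-state
  ... | just b' with b' Bool.≟ b
  ...   | yes refl = ⊥-elim (no-swap t r b 1+t≤p t-state t-¬b)
  ...   | no b'≢b with recolouring⇒hole r b s t s≤t (<⇒≤ 1+t≤p) s-b (trans t-state (cong just (¬-not b'≢b)))
  ...     | i , s≤i , i≤t , hole = i , s≤i , m≤n⇒m≤1+n i≤t , hole

  parent grandchild : ℕ → Fin 3 → ℕ
  parent r Fin.zero = 2 * r + 1
  parent r (Fin.suc Fin.zero) = 2 * r + 1
  parent r (Fin.suc (Fin.suc Fin.zero)) = 2 * r + 2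
  grandchild r Fin.zero = 2 * (2 * r + 1) + 1
  grandchild r (Fin.suc Fin.zero) = 2 * (2 * r + 1) + 2
  grandchild r (Fin.suc (Fin.suc Fin.zero)) = 2 * (2 * r + 2) + 1

  isChild-parent : ∀ r κ → IsChild r (parent r κ)
  isChild-parent r Fin.zero = inj₁ refl
  isChild-parent r (Fin.suc Fin.zero) = inj₁ refl
  isChild-parent r (Fin.suc (Fin.suc Fin.zero)) = inj₂ refl

  isChild-grandchild : ∀ r κ → IsChild (parent r κ) (grandchild r κ)
  isChild-grandchild r Fin.zero = inj₁ refl
  isChild-grandchild r (Fin.suc Fin.zero) = inj₂ refl
  isChild-grandchild r (Fin.suc (Fin.suc Fin.zero)) = inj₁ refl

  Alternating-grandchild : ∀ i r j b → Alternating i r (suc (suc j)) b → ∀ κ → Alternating i (grandchild r κ) j b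
  Alternating-grandchild i r j b (_ , (_ , g₀ , g₁) , (_ , g₂ , _)) κ =
    subst (Alternating i (grandchild r κ) j) (not-involutive b) (pick κ)
    where
    pick : ∀ κ → Alternating i (grandchild r κ) j (not (not b))
    pick Fin.zero = g₀
    pick (Fin.suc Fin.zero) = g₁
    pick (Fin.suc (Fin.suc Fin.zero)) = g₂

  holeTerms : ℕ → ℕ → ℕ → Vec ℕ 7
  holeTerms i r j = h r ∷ h (2 * r + 1) ∷ h (2 * r + 2)
    ∷ holes i (2 * (2 * r + 1) + 1) j ∷ holes i (2 * (2 * r + 1) + 2) j
    ∷ holes i (2 * (2 * r + 2) + 1) j ∷ holes i (2 * (2 * r + 2) + 2) j ∷ []
    where h = holeIndicator ∘ state i

  holes≡sum-holeTerms : ∀ i r j → holes i r (suc (suc j)) ≡ sum (holeTerms i r j)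
  holes≡sum-holeTerms i r j = regroup (h r) (h (2 * r + 1)) (h (2 * r + 2))
    (holes i (2 * (2 * r + 1) + 1) j) (holes i (2 * (2 * r + 1) + 2) j)
    (holes i (2 * (2 * r + 2) + 1) j) (holes i (2 * (2 * r + 2) + 2) j)
    where
    regroup : ∀ a b c d e f g → a + (b + d + e) + (c + f + g) ≡ a + (b + (c + (d + (e + (f + (g + 0))))))
    regroup = solve-∀
    h = holeIndicator ∘ state i

  rootSlot : Fin 7
  rootSlot = Fin.zero

  parentSlot grandchildSlot : Fin 3 → Fin 7
  parentSlot Fin.zero = Fin.suc Fin.zero
  parentSlot (Fin.suc Fin.zero) = Fin.suc Fin.zero
  parentSlot (Fin.suc (Fin.suc Fin.zero)) = Fin.suc (Fin.suc Fin.zero)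
  grandchildSlot κ = 3 ↑ʳ Fin.inject₁ κ

  lookup-parentSlot : ∀ i r j κ → lookup (holeTerms i r j) (parentSlot κ) ≡ holeIndicator (state i (parent r κ))
  lookup-parentSlot i r j Fin.zero = refl
  lookup-parentSlot i r j (Fin.suc Fin.zero) = refl
  lookup-parentSlot i r j (Fin.suc (Fin.suc Fin.zero)) = refl

  lookup-grandchildSlot : ∀ i r j κ → lookup (holeTerms i r j) (grandchildSlot κ) ≡ holes i (grandchild r κ) j
  lookup-grandchildSlot i r j Fin.zero = refl
  lookup-grandchildSlot i r j (Fin.suc Fin.zero) = refl
  lookup-grandchildSlot i r j (Fin.suc (Fin.suc Fin.zero)) = refl

  parentSlot≢grandchildSlot : ∀ κ' κ → parentSlot κ' ≢ grandchildSlot κ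
  parentSlot≢grandchildSlot Fin.zero κ ()
  parentSlot≢grandchildSlot (Fin.suc Fin.zero) κ ()
  parentSlot≢grandchildSlot (Fin.suc (Fin.suc Fin.zero)) κ ()

  holeTerms-others≡0 : ∀ i r j h κ → holes i r (suc (suc j)) ≤ h → h ≤ holes i (grandchild r κ) j →
    ∀ σ → σ ≢ grandchildSlot κ → lookup (holeTerms i r j) σ ≡ 0
  holeTerms-others≡0 i r j h κ total≤h h≤κ = sum≤lookup⇒others≡0 (holeTerms i r j) (grandchildSlot κ) $
    begin
      sum (holeTerms i r j)                          ≡⟨ sym (holes≡sum-holeTerms i r j) ⟩
      holes i r (suc (suc j))                        ≤⟨ total≤h ⟩
      h                                              ≤⟨ h≤κ ⟩
      holes i (grandchild r κ) j                     ≡⟨ sym (lookup-grandchildSlot i r j κ) ⟩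
      lookup (holeTerms i r j) (grandchildSlot κ)    ∎
    where open ≤-Reasoning

  -- All holes being in grandchild subtree κ, the root, the other grandchild subtrees and their
  -- parents are hole-free, so colours propagate down from the root.
  others-alternate : ∀ i r j h κ → holes i r (suc (suc j)) ≤ h → h ≤ holes i (grandchild r κ) j →
    Σ Bool λ b → ∀ κ' → κ' ≢ κ → Alternating i (grandchild r κ') j b
  others-alternate i r j h κ total≤h h≤κ with holeIndicator≡0 (state i r) (others≡0 rootSlot λ ())
    where others≡0 = holeTerms-others≡0 i r j h κ total≤h h≤κ
  ... | b , root = not (not b) , λ κ' κ'≢κ →
    holes≡0⇒Alternating i (grandchild r κ') j (not (not b)) (grandchild≡0 κ' κ'≢κ)
      (child-colour i (parent r κ') (grandchild r κ') (not b) (isChild-grandchild r κ')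
        (child-colour i r (parent r κ') b (isChild-parent r κ') root (parent≡0 κ'))
        (n≤0⇒n≡0 (≤-trans (root≤subtreeSum _ (grandchild r κ') j) (≤-reflexive (grandchild≡0 κ' κ'≢κ)))))
    where
    others≡0 = holeTerms-others≡0 i r j h κ total≤h h≤κ
    parent≡0 : ∀ κ' → holeIndicator (state i (parent r κ')) ≡ 0
    parent≡0 κ' = trans (sym (lookup-parentSlot i r j κ')) (others≡0 (parentSlot κ') (parentSlot≢grandchildSlot κ' κ))
    grandchild≡0 : ∀ κ' → κ' ≢ κ → holes i (grandchild r κ') j ≡ 0
    grandchild≡0 κ' κ'≢κ = trans (sym (lookup-grandchildSlot i r j κ'))
      (others≡0 (grandchildSlot κ') (κ'≢κ ∘ inject₁-injective ∘ ↑ʳ-injective 3 _ _))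

  Recolouring⇒Holes : ℕ → Set
  Recolouring⇒Holes j = ∀ r b s t → s ≤ t → t ≤ p → Alternating s r j b → Alternating t r j (not b) →
    Σ ℕ λ i → s ≤ i × i ≤ t × suc ⌊ j /2⌋ ≤ holes i r j

  -- If the depth-(2+j) subtree never has ⌊j/2⌋+2 holes, then whenever the recolouring of one of
  -- three grandchild subtrees forces ⌊j/2⌋+1 holes into it, the other two alternate in phase,
  -- which ThreeSwitches rules out.
  recolouring⇒holes-+2 : ∀ j → Recolouring⇒Holes j → Recolouring⇒Holes (suc (suc j))
  recolouring⇒holes-+2 j below r b s t s≤t t≤p before after with anyUpTo? many? (suc t)
    where
    many? : ∀ i → Dec (s ≤ i × suc (suc ⌊ j /2⌋) ≤ holes i r (suc (suc j)))
    many? i = (s ≤? i) ×-dec (suc (suc ⌊ j /2⌋) ≤? holes i r (suc (suc j)))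
  ... | yes (i , i<1+t , s≤i , enough) = i , s≤i , ≤-pred i<1+t , enough
  ... | no none = ⊥-elim (ThreeSwitches.not-all-before Before After Busy s t
          (idle b) (idle (not b)) busy-between others-agree (Alternating-grandchild t r j (not b) after)
          s≤t (Alternating-grandchild s r j b before))
    where
    h = suc ⌊ j /2⌋
    Before After Busy : Fin 3 → ℕ → Set
    Before κ i = Alternating i (grandchild r κ) j b
    After κ i = Alternating i (grandchild r κ) j (not b)
    Busy κ i = h ≤ holes i (grandchild r κ) j
    idle : ∀ b κ i → Alternating i (grandchild r κ) j b → Busy κ i → ⊥
    idle b κ i alt busy = n≮0 (≤-trans busy (≤-reflexive (Alternating⇒holes≡0 i (grandchild r κ) j b alt)))
    busy-between : ∀ κ a a' → s ≤ a → a ≤ a' → a' ≤ t → Before κ a → After κ a' →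
      Σ ℕ λ i → a ≤ i × i ≤ a' × Busy κ i
    busy-between κ a a' _ a≤a' a'≤t = below (grandchild r κ) b a a' a≤a' (≤-trans a'≤t t≤p)
    few : ∀ i → s ≤ i → i ≤ t → holes i r (suc (suc j)) ≤ h
    few i s≤i i≤t = ≮⇒≥ (λ h<holes → none (i , s≤s i≤t , s≤i , h<holes))
    others-agree : ∀ κ i → s ≤ i → i ≤ t → Busy κ i →
      (∀ κ' → κ' ≢ κ → Before κ' i) ⊎ (∀ κ' → κ' ≢ κ → After κ' i)
    others-agree κ i s≤i i≤t busy with others-alternate i r j h κ (few i s≤i i≤t) busy
    ... | b' , alt with b' Bool.≟ b
    ...   | yes refl = inj₁ alt
    ...   | no b'≢b = inj₂ (λ κ' κ'≢κ → subst (Alternating i (grandchild r κ') j) (¬-not b'≢b) (alt κ' κ'≢κ))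

  recolouring⇒holes : ∀ j → Recolouring⇒Holes j
  recolouring⇒holes zero r b s t s≤t t≤p before after
    with recolouring⇒hole r b s t s≤t t≤p before after
  ... | i , s≤i , i≤t , hole = i , s≤i , i≤t , ≤-reflexive (sym (cong holeIndicator hole))
  recolouring⇒holes (suc zero) r b s t s≤t t≤p before after
    with recolouring⇒hole r b s t s≤t t≤p (Alternating-root s r 1 b before) (Alternating-root t r 1 (not b) after)
  ... | i , s≤i , i≤t , hole =
    i , s≤i , i≤t , ≤-trans (≤-reflexive (sym (cong holeIndicator hole))) (root≤subtreeSum (holeIndicator ∘ state i) r 1)
  recolouring⇒holes (suc (suc j)) = recolouring⇒holes-+2 j (recolouring⇒holes j)

floor*↧≤↥ : ∀ p → floor p ℤ.* ↧ p ℤ.≤ ↥ p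
floor*↧≤↥ p@record{} = [n/d]*d≤n (↥ p) (↧ p)

floor*d≤n : ∀ p g n d .{{_ : ℤ.NonNegative g}} → ↥ p ℤ.* g ≡ n → ↧ p ℤ.* g ≡ d → floor p ℤ.* d ℤ.≤ n
floor*d≤n p g n d refl refl = begin
  floor p ℤ.* (↧ p ℤ.* g)   ≡⟨ sym (ℤ.*-assoc (floor p) (↧ p) g) ⟩
  floor p ℤ.* ↧ p ℤ.* g     ≤⟨ ℤ.*-monoʳ-≤-nonNeg g (floor*↧≤↥ p) ⟩
  ↥ p ℤ.* g                 ∎
  where open ℤ.≤-Reasoning

floor[½*k]*2≤k : ∀ k → floor (½ ℚ.* (ℤ.+ k ℚ./ 1)) ℤ.* ℤ.+ 2 ℤ.≤ ℤ.+ k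
floor[½*k]*2≤k k rewrite normalize-coprime {k} {0} (Coprime.sym (1-coprimeTo k)) =
  subst (floor (½ ℚ.* Q) ℤ.* ℤ.+ 2 ℤ.≤_) (ℤ.*-identityˡ (ℤ.+ k)) (floor*d≤n (½ ℚ.* Q) _ _ _ (↥-* ½ Q) (↧-* ½ Q))
  where
  Q = mkℚ (ℤ.+ k) 0 (Coprime.sym (1-coprimeTo k))

≤suc⌊/2⌋*2 : ∀ k → k ≤ suc ⌊ k /2⌋ * 2
≤suc⌊/2⌋*2 zero = z≤n
≤suc⌊/2⌋*2 (suc zero) = s≤s z≤n
≤suc⌊/2⌋*2 (suc (suc k)) = s≤s (s≤s (≤suc⌊/2⌋*2 k))

floor[½*k]≤ : ∀ k h → suc ⌊ k /2⌋ ≤ h → floor (½ ℚ.* (ℤ.+ k ℚ./ 1)) ℤ.≤ ℤ.+ h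
floor[½*k]≤ k h enough = ℤ.*-cancelʳ-≤-pos _ (ℤ.+ h) (ℤ.+ 2) (begin
  floor (½ ℚ.* (ℤ.+ k ℚ./ 1)) ℤ.* ℤ.+ 2   ≤⟨ floor[½*k]*2≤k k ⟩
  ℤ.+ k                                   ≤⟨ ℤ.+≤+ (≤-trans (≤suc⌊/2⌋*2 k) (*-monoˡ-≤ 2 enough)) ⟩
  ℤ.+ (h * 2)                             ≡⟨ ℤ.pos-* h 2 ⟩
  ℤ.+ h ℤ.* ℤ.+ 2                         ∎)
  where open ℤ.≤-Reasoning

+w≤+a-z : ∀ w h a z → w + h ≡ a → z ℤ.≤ ℤ.+ h → ℤ.+ w ℤ.≤ ℤ.+ a ℤ.- z
+w≤+a-z w h a z refl z≤h = begin
  ℤ.+ w                              ≤⟨ ℤ.i≤i+j (ℤ.+ w) (ℤ.+ h ℤ.- z) {{ℤ.nonNegative (ℤ.i≤j⇒0≤j-i z≤h)}} ⟩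
  ℤ.+ w ℤ.+ (ℤ.+ h ℤ.- z)            ≡⟨ sym (ℤ.+-assoc (ℤ.+ w) (ℤ.+ h) (ℤ.- z)) ⟩
  ℤ.+ (w + h) ℤ.- z                  ∎
  where open ℤ.≤-Reasoning

clamp : ∀ p → ℕ → Fin (suc p)
clamp zero _ = Fin.zero
clamp (suc p) zero = Fin.zero
clamp (suc p) (suc i) = Fin.suc (clamp p i)

clamp-0 : ∀ p → clamp p 0 ≡ Fin.zero
clamp-0 zero = refl
clamp-0 (suc p) = refl

clamp-p : ∀ p → clamp p p ≡ Fin.fromℕ p
clamp-p zero = refl
clamp-p (suc p) = cong Fin.suc (clamp-p p)

clamp-step : ∀ p i → i < p → Σ (Fin p) λ j → (clamp p i ≡ Fin.inject₁ j) × (clamp p (suc i) ≡ Fin.suc j)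
clamp-step (suc p) zero _ = Fin.zero , refl , cong Fin.suc (clamp-0 p)
clamp-step (suc p) (suc i) (s≤s i<p) with clamp-step p i i<p
... | j , eq , eq' = Fin.suc j , cong Fin.suc eq , cong Fin.suc eq'

-- colour of a node from (u_t ∈ S, v_t ∈ S): nothing for a hole
nodeState : Bool → Bool → Maybe Bool
nodeState true _ = just true
nodeState false true = just false
nodeState false false = nothing

holeIndicator-nodeState : ∀ a c → holeIndicator (nodeState a c) ≡ fromBool (not a ∧ not c)
holeIndicator-nodeState true c = refl
holeIndicator-nodeState false true = refl
holeIndicator-nodeState false false = refl

module ReconfigurationPaths (k : ℕ) where
  open Coordinates k
  open MaximumIndependentSets k

  xor-count≤∣△∣ : ∀ S T x → x < m → fromBool (u S x xor u T x) + fromBool (v S x xor v T x) ≤ ∣ S △ T ∣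
  xor-count≤∣△∣ S T x x<m = begin
    fromBool (u S x xor u T x) + fromBool (v S x xor v T x)
      ≡⟨ sym (cong₂ (λ a c → fromBool a + fromBool c) (atU-zipWith _xor_ refl m S T x) (atV-zipWith _xor_ refl m S T x)) ⟩
    fromBool (u (S △ T) x) + fromBool (v (S △ T) x)
      ≤⟨ +-mono-≤ (term≤sumFrom (fromBool ∘ u (S △ T)) 0 m x z≤n x<m) (term≤sumFrom (fromBool ∘ v (S △ T)) 0 m x z≤n x<m) ⟩
    sumFrom (fromBool ∘ u (S △ T)) 0 m + sumFrom (fromBool ∘ v (S △ T)) 0 m
      ≡⟨ sym (∣∣≡sumFrom-atU+atV m (S △ T)) ⟩
    ∣ S △ T ∣ ∎
    where open ≤-Reasoning

  module AlongPath {I J : Subset (n (G k))} (P : ReconfPath (G k) I J) where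
    open ReconfPath P

    set : ℕ → Subset (n (G k))
    set i = W (clamp p i)

    set-treeIndependent : ∀ i → TreeIndependent (set i)
    set-treeIndependent i = independent⇒treeIndependent (set i) (indep (clamp p i))

    state : ℕ → ℕ → Maybe Bool
    state i x = nodeState (u (set i) x) (v (set i) x)

    state-u : ∀ i x → state i x ≡ just true → u (set i) x ≡ true × v (set i) x ≡ false
    state-u i x eq with u (set i) x in eu | v (set i) x in ev | eq
    ... | true | true | _ = ⊥-elim (TreeIndependent.not-uv (set-treeIndependent i) x eu ev)
    ... | true | false | _ = refl , refl

    state-v : ∀ i x → state i x ≡ just false → u (set i) x ≡ false × v (set i) x ≡ true
    state-v i x eq with u (set i) x | v (set i) x | eq
    ... | false | true | _ = refl , refl

    alternating : ∀ i x y b b' → IsChild x y → state i x ≡ just b → state i y ≡ just b' → b' ≡ not b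
    alternating i x y true true ch ex ey =
      ⊥-elim (TreeIndependent.not-uu (set-treeIndependent i) x y ch (proj₁ (state-u i x ex)) (proj₁ (state-u i y ey)))
    alternating i x y true false ch ex ey = refl
    alternating i x y false true ch ex ey = refl
    alternating i x y false false ch ex ey =
      ⊥-elim (TreeIndependent.not-vv (set-treeIndependent i) x y ch (proj₂ (state-v i x ex)) (proj₂ (state-v i y ey)))

    -- Recolouring a node in one step would change both u and v.
    no-swap : ∀ i x b → i < p → state i x ≡ just b → state (suc i) x ≡ just (not b) → ⊥
    no-swap i x b i<p before after with clamp-step p i i<p
    ... | j , eq , eq' = <-irrefl refl (≤-trans (two≤ b before after)
          (subst (λ (S , T) → ∣ S △ T ∣ ≤ 1) (cong₂ _,_ (cong W (sym eq)) (cong W (sym eq'))) (step j)))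
      where
      S = set i
      T = set (suc i)
      xor-not : ∀ a → (a xor not a) ≡ true
      xor-not true = refl
      xor-not false = refl
      flipped : ∀ b → state i x ≡ just b → state (suc i) x ≡ just (not b) →
        (u T x ≡ not (u S x)) × (v T x ≡ not (v S x)) × x < m
      flipped true before after with state-u i x before | state-v (suc i) x after
      ... | uS , vS | uT , vT = trans uT (cong not (sym uS)) , trans vT (cong not (sym vS)) , atU-true⇒< m S x uS
      flipped false before after with state-v i x before | state-u (suc i) x after
      ... | uS , vS | uT , vT = trans uT (cong not (sym uS)) , trans vT (cong not (sym vS)) , atV-true⇒< m S x vS
      two≤ : ∀ b → state i x ≡ just b → state (suc i) x ≡ just (not b) → 1 < ∣ S △ T ∣
      two≤ b before after with flipped b before after
      ... | uT , vT , x<m = subst (_≤ ∣ S △ T ∣)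
            (cong₂ (λ a c → fromBool a + fromBool c) (trans (cong (u S x xor_) uT) (xor-not (u S x)))
                                                     (trans (cong (v S x xor_) vT) (xor-not (v S x))))
            (xor-count≤∣△∣ S T x x<m)

    open ColourSwitching p state alternating no-swap

    state-decode : ∀ rb i → set i ≡ decode rb [] → ∀ x → x < m → state i x ≡ just (colour rb [] x)
    state-decode rb i eq x x<m rewrite eq | u-decode rb [] x x<m | v-decode rb [] x x<m with colour rb [] x
    ... | true = refl
    ... | false = refl

    -- the depth-j subtree at r lies within T_k
    Fits : ℕ → ℕ → Set
    Fits j r = 2 ^ j * (r + 2) ≤ 2 ^ (k + 1)

    fits⇒< : ∀ j r → Fits j r → r < m
    fits⇒< j r fits = ≤-pred (begin
      2 + r              ≡⟨ +-comm 2 r ⟩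
      r + 2              ≡⟨ sym (*-identityˡ (r + 2)) ⟩
      1 * (r + 2)        ≤⟨ *-monoˡ-≤ (r + 2) (m^n>0 2 j) ⟩
      2 ^ j * (r + 2)    ≤⟨ fits ⟩
      2 ^ (k + 1)        ≡⟨ sym (suc-nodes k) ⟩
      suc m              ∎)
      where open ≤-Reasoning

    decode-Alternating : ∀ rb i → set i ≡ decode rb [] → ∀ j r → Fits j r → Alternating i r j (colour rb [] r)
    decode-Alternating rb i eq zero r fits = state-decode rb i eq r (fits⇒< 0 r fits)
    decode-Alternating rb i eq (suc j) r fits =
      state-decode rb i eq r (fits⇒< (suc j) r fits) ,
      subst (Alternating i (2 * r + 1) j) (colour-child rb [] r (2 * r + 1) (inj₁ refl) refl)
        (decode-Alternating rb i eq j (2 * r + 1) (≤-trans (fits-left (2 ^ j) r) fits)) ,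
      subst (Alternating i (2 * r + 2) j) (colour-child rb [] r (2 * r + 2) (inj₂ refl) refl)
        (decode-Alternating rb i eq j (2 * r + 2) (≤-trans (≤-reflexive (fits-right (2 ^ j) r)) fits))
      where
      fits-left : ∀ x r → x * ((2 * r + 1) + 2) ≤ 2 * x * (r + 2)
      fits-left x r = ≤-trans (m≤m+n _ x) (≤-reflexive (regroup x r))
        where
        regroup : ∀ x r → x * ((2 * r + 1) + 2) + x ≡ 2 * x * (r + 2)
        regroup = solve-∀
      fits-right : ∀ x r → x * ((2 * r + 2) + 2) ≡ 2 * x * (r + 2)
      fits-right = solve-∀

    holes≡holeCount : ∀ i → holes i 0 k ≡ holeCount (set i)
    holes≡holeCount i = trans (subtreeSum-root≡sumFrom _ k)
      (sumFrom-cong _ _ 0 m (λ t _ _ → holeIndicator-nodeState (u (set i) t) (v (set i) t)))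

    recolouring⇒many-holes : ∀ rb → set 0 ≡ decode rb [] → set p ≡ decode (not rb) [] →
      Σ ℕ λ i → suc ⌊ k /2⌋ ≤ holeCount (set i)
    recolouring⇒many-holes rb start≡ finish≡
      with recolouring⇒holes k 0 rb 0 p z≤n ≤-refl (decode-Alternating rb 0 start≡ k 0 whole)
             (decode-Alternating (not rb) p finish≡ k 0 whole)
      where
      whole : Fits k 0
      whole = ≤-reflexive (trans (*-comm (2 ^ k) 2) (cong (2 ^_) (+-comm 1 k)))
    ... | i , _ , _ , enough = i , subst (suc ⌊ k /2⌋ ≤_) (holes≡holeCount i) enough

    many-holes : ∀ rb → I ≡ decode rb [] → J ≡ decode (not rb) [] →
      Σ (Fin (suc p)) λ i → suc ⌊ k /2⌋ ≤ holeCount (W i)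
    many-holes rb I≡ J≡ with recolouring⇒many-holes rb (trans (cong W (clamp-0 p)) (trans start I≡))
                                                         (trans (cong W (clamp-p p)) (trans finish J≡))
    ... | i , enough = clamp p i , enough

  small-set-on-path : ∀ I J → MaximumIndependent (G k) I → MaximumIndependent (G k) J → I ≢ J →
    ∀ a → IsIndependenceNumber (G k) a → (P : ReconfPath (G k) I J) →
    ∃ λ (i : Fin (suc (ReconfPath.p P))) →
      ℤ.+ ∣ ReconfPath.W P i ∣ ℤ.≤ ℤ.+ a ℤ.- floor (½ ℚ.* (ℤ.+ k ℚ./ 1))
  small-set-on-path I J maxI maxJ I≢J a isα P with found (maximum⇒Iₖ⊎Jₖ I maxI) (maximum⇒Iₖ⊎Jₖ J maxJ)
    where
    open AlongPath P using (many-holes)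
    found : (I ≡ Iₖ) ⊎ (I ≡ Jₖ) → (J ≡ Iₖ) ⊎ (J ≡ Jₖ) →
      Σ (Fin (suc (ReconfPath.p P))) λ i → suc ⌊ k /2⌋ ≤ holeCount (ReconfPath.W P i)
    found (inj₁ I≡Iₖ) (inj₁ J≡Iₖ) = ⊥-elim (I≢J (trans I≡Iₖ (sym J≡Iₖ)))
    found (inj₁ I≡Iₖ) (inj₂ J≡Jₖ) = many-holes true I≡Iₖ J≡Jₖ
    found (inj₂ I≡Jₖ) (inj₁ J≡Iₖ) = many-holes false I≡Jₖ J≡Iₖ
    found (inj₂ I≡Jₖ) (inj₂ J≡Jₖ) = ⊥-elim (I≢J (trans I≡Jₖ (sym J≡Jₖ)))
  ... | i , enough = i , +w≤+a-z (∣ S ∣) (holeCount S) a _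
        (trans (∣∣+holeCount≡m S (independent⇒treeIndependent S (ReconfPath.indep P i))) (sym (independenceNumber≡m a isα)))
        (floor[½*k]≤ k (holeCount S) enough)
    where S = ReconfPath.W P i

0<½ : 0ℚ ℚ.< ½
0<½ = ℚ.*<* (ℤ.+<+ (s≤s z≤n))

lemma12 :
    (∀ (k : ℕ) →
        (n (G k) ≡ 2 ^ (k + 2) ∸ 2)
      × Σ (Subset (n (G k))) (λ I → Σ (Subset (n (G k))) (λ J →
            MaximumIndependent (G k) I
          × MaximumIndependent (G k) J
          × I ≢ J
          × (∀ S → MaximumIndependent (G k) S → (S ≡ I) ⊎ (S ≡ J))
          × ∣ I ∣ ≡ 2 ^ (k + 1) ∸ 1
          × ∣ J ∣ ≡ 2 ^ (k + 1) ∸ 1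
          × (I ∩ J ≡ ∅)
          × (I ∪ J ≡ full))))
    × Σ ℚ (λ c₁ → (0ℚ ℚ.< c₁) ×
        (∀ (k : ℕ) (I J : Subset (n (G k))) →
           MaximumIndependent (G k) I → MaximumIndependent (G k) J → I ≢ J →
           ∀ (a : ℕ) → IsIndependenceNumber (G k) a →
           (P : ReconfPath (G k) I J) →
           ∃ λ (i : Fin (suc (ReconfPath.p P))) →
             ℤ.+ ∣ ReconfPath.W P i ∣ ℤ.≤ ℤ.+ a ℤ.- floor (c₁ ℚ.* (ℤ.+ k ℚ./ 1))))
    × (∀ (k d a : ℕ) → IsIndependenceNumber (G k) a →
         (L : List (Subset (n (G k)))) → Unique L →
         All (λ S → Independent (G k) S × (∣ S ∣ + d ≡ a)) L →
         length L ≤ 2 ^ (2 * d + 1) * a ^ d)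
lemma12 =
    (λ k → let open MaximumIndependentSets k in
      vertexCount k , Iₖ , Jₖ , decode-[]-maximum true , decode-[]-maximum false , Iₖ≢Jₖ , maximum⇒Iₖ⊎Jₖ ,
      ∣decode-[]∣ true , ∣decode-[]∣ false , Iₖ∩Jₖ≡∅ , Iₖ∪Jₖ≡full)
  , (½ , 0<½ , ReconfigurationPaths.small-set-on-path)
  , IndependentSetsOfGivenSize.setsOfSize-bound
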